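{- Let $w \in S_n$ be a fully commutative permutation. Then there exist permutations $\hat{w}, w' \in S_n$ such that $w = \hat{w} w'$, $\ell(w) = \ell(\hat{w}) + \ell(w')$, the permutation $\hat{w}$ is boolean, and $\operatorname{supp}(\hat{w}) = \operatorname{supp}(w)$. Furthermore, such a $\hat{w}$ is uniquely determined by $w$.
   Context: $S_n$ is the symmetric group, generated by the simple reflections $s_1,\dots,s_{n-1}$, where $s_i$ swaps $i$ and $i+1$. The length $\ell(w)$ is the minimum number of simple reflections in an expression for $w$ (equivalently, the number of inversions of $w$). A reduced word of $w$ is a word $i_1\cdots i_{\ell(w)}$ with $w = s_{i_1}\cdots s_{i_{\ell(w)}}$. The support $\operatorname{supp}(w)$ is the set of letters appearing in reduced words of $w$. A permutation is fully commutative if any two of its reduced words are related by a sequence of commutation moves $s_is_j=s_js_i$ ($|i-j|>1$); equivalently, it avoids the pattern $321$. A permutation is boolean if it avoids the patterns $321$ and $3412$; equivalently, some (equivalently every) reduced word of it consists of distinct letters. -}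

module Defs where

open import Data.Nat using (ℕ; suc; _<_; _+_)
open import Data.Nat.Properties using (<-trans; n<1+n)
open import Data.Fin using (Fin; fromℕ<) renaming (_<_ to _<ᶠ_; _<?_ to _<ᶠ?_)
open import Data.Fin.Permutation
  using (Permutation′; _⟨$⟩ʳ_; _∘ₚ_; id; transpose; _≈_)
open import Data.List using (List; []; _∷_; length; filter; cartesianProduct; allFin; map)
open import Data.List.Membership.Propositional using (_∈_)
open import Data.Product using (Σ; ∃; _×_; _,_; proj₁; proj₂)
open import Relation.Binary.PropositionalEquality using (_≡_)
open import Relation.Nullary using (¬_)
open import Relation.Nullary.Decidable using (_×-dec_)

-- S_n : permutations of Fin n = {0,…,n-1} (the paper's {1,…,n}, shifted by one).
Perm : ℕ → Set
Perm n = Permutation′ n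

-- Product in S_n as composition of functions: (u · v)(i) = u (v i).
infixl 7 _·_
_·_ : ∀ {n} → Perm n → Perm n → Perm n
u · v = v ∘ₚ u

-- Letters of words: k with k+1 < n, standing for s_{k+1} which swaps
-- the (0-based) positions k and k+1.
Letter : ℕ → Set
Letter n = Σ ℕ (λ k → suc k < n)

s : ∀ {n} → Letter n → Perm n
s (k , p) = transpose (fromℕ< (<-trans (n<1+n k) p)) (fromℕ< p)

prod : ∀ {n} → List (Letter n) → Perm n
prod []       = id
prod (l ∷ ls) = s l · prod ls

inversions : ∀ {n} → Perm n → List (Fin n × Fin n)
inversions {n} w =
  filter (λ ij → (proj₁ ij <ᶠ? proj₂ ij) ×-dec (w ⟨$⟩ʳ proj₂ ij <ᶠ? w ⟨$⟩ʳ proj₁ ij))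
         (cartesianProduct (allFin n) (allFin n))

ℓ : ∀ {n} → Perm n → ℕ
ℓ w = length (inversions w)

IsReducedWord : ∀ {n} → Perm n → List (Letter n) → Set
IsReducedWord w ws = (prod ws ≈ w) × (length ws ≡ ℓ w)

InSupp : ∀ {n} → Perm n → ℕ → Set
InSupp {n} w k = Σ (List (Letter n)) (λ ws → IsReducedWord w ws × (k ∈ map proj₁ ws))

Contains321 : ∀ {n} → Perm n → Set
Contains321 {n} w = Σ (Fin n) λ i → Σ (Fin n) λ j → Σ (Fin n) λ k →
  (i <ᶠ j) × (j <ᶠ k) × (w ⟨$⟩ʳ k <ᶠ w ⟨$⟩ʳ j) × (w ⟨$⟩ʳ j <ᶠ w ⟨$⟩ʳ i)

Contains3412 : ∀ {n} → Perm n → Set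
Contains3412 {n} w = Σ (Fin n) λ i → Σ (Fin n) λ j → Σ (Fin n) λ k → Σ (Fin n) λ l →
  (i <ᶠ j) × (j <ᶠ k) × (k <ᶠ l) ×
  (w ⟨$⟩ʳ k <ᶠ w ⟨$⟩ʳ l) × (w ⟨$⟩ʳ l <ᶠ w ⟨$⟩ʳ i) × (w ⟨$⟩ʳ i <ᶠ w ⟨$⟩ʳ j)

FullyCommutative : ∀ {n} → Perm n → Set
FullyCommutative w = ¬ Contains321 w

Boolean : ∀ {n} → Perm n → Set
Boolean w = ¬ Contains321 w × ¬ Contains3412 w

SameSupp : ∀ {n} → Perm n → Perm n → Set
SameSupp u v = ∀ k → (InSupp u k → InSupp v k) × (InSupp v k → InSupp u k)

BoolFactor : ∀ {n} → Perm n → Perm n → Set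
BoolFactor {n} w ŵ = Σ (Perm n) λ w' →
  (w ≈ ŵ · w') × (ℓ w ≡ ℓ ŵ + ℓ w') × Boolean ŵ × SameSupp ŵ w

-- Write x = w⁻¹ and u = ŵ⁻¹.  Then ŵ is a length-additive left factor of w iff every inversion (pair of
-- positions) of u is one of x, and k ∈ supp v iff v moves some position ≤ k to a value > k, i.e. crosses
-- the cut between k and k+1.  Existence is by induction on ℓ x: write x = s · x₁ along a left descent
-- s = s_{k+1}, take the core u₁ of x₁, and use s · u₁ when x₁ does not cross the cut at k: then, as x avoids
-- 321, x₁ and u₁ put the values k and k+1 at the same positions, so s · u₁ is again boolean and below x.
-- For uniqueness, a boolean permutation has at most one upward and one downward crossing at each cut;
-- comparing two cores at a position that is an excedance, a fixed point or a deficiency of each always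
-- produces a 321 in x.
module Submission where

open import Defs
open import Data.Nat as ℕ using (ℕ; zero; suc; _+_; _≤_; _<_; z≤n; s≤s)
open import Data.Nat.Properties
open import Data.Fin as F using (Fin; toℕ; fromℕ<)
open import Data.Fin.Properties as FP using (toℕ-injective; toℕ-fromℕ<)
open import Data.Fin.Permutation as P using (_⟨$⟩ʳ_; _⟨$⟩ˡ_; flip; _≈_; inverseˡ; inverseʳ)
open import Data.List using (List; []; _∷_; length; filter; cartesianProduct; tabulate; map; _++_; reverse; _∷ʳ_)
open import Data.List.Properties using (filter-++; length-++; map-tabulate; unfold-reverse; length-reverse)
open import Data.List.Membership.Propositional using (_∈_)
open import Data.List.Relation.Unary.Any using (here; there)
open import Data.Product using (Σ; _×_; _,_; proj₁; proj₂)
open import Data.Sum using (_⊎_; inj₁; inj₂; [_,_]′)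
open import Relation.Binary.Definitions using (Tri; tri<; tri≈; tri>)
open import Data.Empty using (⊥; ⊥-elim)
open import Relation.Binary.PropositionalEquality
open import Relation.Nullary using (¬_; Dec; yes; no; ¬?)
open import Relation.Nullary.Decidable using (_×-dec_)
open import Relation.Unary using (Decidable; _⊆_)
open import Algebra.Properties.CommutativeMonoid.Sum +-0-commutativeMonoid using (sum; sum-cong-≗; ∑-distrib-+; sum-permute)
open import Function using (_∘_)

data SwapView (k : ℕ) : ℕ → Set where
  at-k   : SwapView k k
  at-1+k : SwapView k (suc k)
  away   : ∀ {y} → y ≢ k → y ≢ suc k → SwapView k y

swapView : ∀ k y → SwapView k y
swapView k y with y ℕ.≟ k | y ℕ.≟ suc k
... | yes refl | _        = at-k
... | no _     | yes refl = at-1+k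
... | no y≢k   | no y≢1+k = away y≢k y≢1+k

swapℕ : ℕ → ℕ → ℕ
swapℕ k y with swapView k y
... | at-k     = suc k
... | at-1+k   = k
... | away _ _ = y

swapℕ-k : ∀ k → swapℕ k k ≡ suc k
swapℕ-k k with swapView k k
... | at-k         = refl
... | away k≢k _   = ⊥-elim (k≢k refl)

swapℕ-1+k : ∀ k → swapℕ k (suc k) ≡ k
swapℕ-1+k k with swapView k (suc k)
... | at-1+k         = refl
... | away _ 1+k≢1+k = ⊥-elim (1+k≢1+k refl)

swapℕ-other : ∀ {k y} → y ≢ k → y ≢ suc k → swapℕ k y ≡ y
swapℕ-other {k} {y} y≢k y≢1+k with swapView k y
... | at-k     = ⊥-elim (y≢k refl)
... | at-1+k   = ⊥-elim (y≢1+k refl)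
... | away _ _ = refl

swapℕ-involutive : ∀ k y → swapℕ k (swapℕ k y) ≡ y
swapℕ-involutive k y with swapView k y
... | at-k           = swapℕ-1+k k
... | at-1+k         = swapℕ-k k
... | away y≢k y≢1+k = swapℕ-other y≢k y≢1+k

swapℕ-mono-< : ∀ k {y z} → y < z → ¬ (y ≡ k × z ≡ suc k) → swapℕ k y < swapℕ k z
swapℕ-mono-< k {y} {z} y<z ¬kk with swapView k y | swapView k z
... | at-k   | at-k   = ⊥-elim (<-irrefl refl y<z)
... | at-k   | at-1+k = ⊥-elim (¬kk (refl , refl))
... | at-k   | away _ z≢1+k = ≤∧≢⇒< y<z (z≢1+k ∘ sym)
... | at-1+k | at-k   = ⊥-elim (<-asym y<z (n<1+n k))
... | at-1+k | at-1+k = ⊥-elim (<-irrefl refl y<z)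
... | at-1+k | away _ _ = <-trans (n<1+n k) y<z
... | away _ _ | at-k = <-trans y<z (n<1+n k)
... | away y≢k _ | at-1+k = ≤∧≢⇒< (≤-pred y<z) y≢k
... | away _ _ | away _ _ = y<z

swapℕ-reflects-< : ∀ k {y z} → swapℕ k y < swapℕ k z → ¬ (y ≡ suc k × z ≡ k) → y < z
swapℕ-reflects-< k {y} {z} h ¬kk =
  subst₂ _<_ (swapℕ-involutive k y) (swapℕ-involutive k z) (swapℕ-mono-< k h ¬swapped)
  where
  ¬swapped : ¬ (swapℕ k y ≡ k × swapℕ k z ≡ suc k)
  ¬swapped (e₁ , e₂) = ¬kk ( trans (sym (swapℕ-involutive k y)) (trans (cong (swapℕ k) e₁) (swapℕ-k k))
                            , trans (sym (swapℕ-involutive k z)) (trans (cong (swapℕ k) e₂) (swapℕ-1+k k)))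

swapℕ-cut : ∀ {j k} y → j ≢ k → (j < swapℕ k y → j < y) × (j < y → j < swapℕ k y)
swapℕ-cut {j} {k} y j≢k with swapView k y
... | at-k     = (λ h → ≤∧≢⇒< (≤-pred h) j≢k) , (λ h → <-trans h (n<1+n k))
... | at-1+k   = (λ h → <-trans h (n<1+n k)) , (λ h → ≤∧≢⇒< (≤-pred h) j≢k)
... | away _ _ = (λ h → h) , (λ h → h)

lo hi : ∀ {n} → Letter n → Fin n
lo (k , p) = fromℕ< (<-trans (n<1+n k) p)
hi (k , p) = fromℕ< p

toℕ-lo : ∀ {n} (l : Letter n) → toℕ (lo l) ≡ proj₁ l
toℕ-lo (k , p) = toℕ-fromℕ< _

toℕ-hi : ∀ {n} (l : Letter n) → toℕ (hi l) ≡ suc (proj₁ l)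
toℕ-hi (k , p) = toℕ-fromℕ< _

toℕ-s : ∀ {n} (l : Letter n) y → toℕ (s l ⟨$⟩ʳ y) ≡ swapℕ (proj₁ l) (toℕ y)
toℕ-s l@(k , p) y with y FP.≟ lo l
... | yes refl = trans (toℕ-hi l) (sym (trans (cong (swapℕ k) (toℕ-lo l)) (swapℕ-k k)))
... | no y≢lo with y FP.≟ hi l
...   | yes refl = trans (toℕ-lo l) (sym (trans (cong (swapℕ k) (toℕ-hi l)) (swapℕ-1+k k)))
...   | no y≢hi = sym (swapℕ-other (λ e → y≢lo (toℕ-injective (trans e (sym (toℕ-lo l)))))
                                   (λ e → y≢hi (toℕ-injective (trans e (sym (toℕ-hi l))))))

s-involutive : ∀ {n} (l : Letter n) y → s l ⟨$⟩ʳ (s l ⟨$⟩ʳ y) ≡ y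
s-involutive l y = toℕ-injective (begin
  toℕ (s l ⟨$⟩ʳ (s l ⟨$⟩ʳ y))       ≡⟨ toℕ-s l (s l ⟨$⟩ʳ y) ⟩
  swapℕ k (toℕ (s l ⟨$⟩ʳ y))        ≡⟨ cong (swapℕ k) (toℕ-s l y) ⟩
  swapℕ k (swapℕ k (toℕ y))         ≡⟨ swapℕ-involutive k (toℕ y) ⟩
  toℕ y                             ∎)
  where open ≡-Reasoning
        k = proj₁ l

s⁻¹≡s : ∀ {n} (l : Letter n) y → s l ⟨$⟩ˡ y ≡ s l ⟨$⟩ʳ y
s⁻¹≡s l y = trans (cong (s l ⟨$⟩ˡ_) (sym (s-involutive l y))) (inverseˡ (s l))

s-lo : ∀ {n} (l : Letter n) → s l ⟨$⟩ʳ lo l ≡ hi l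
s-lo l = toℕ-injective (trans (toℕ-s l (lo l))
           (trans (cong (swapℕ (proj₁ l)) (toℕ-lo l)) (trans (swapℕ-k _) (sym (toℕ-hi l)))))

s-hi : ∀ {n} (l : Letter n) → s l ⟨$⟩ʳ hi l ≡ lo l
s-hi l = toℕ-injective (trans (toℕ-s l (hi l))
           (trans (cong (swapℕ (proj₁ l)) (toℕ-hi l)) (trans (swapℕ-1+k _) (sym (toℕ-lo l)))))

lo≢hi : ∀ {n} (l : Letter n) → lo l ≢ hi l
lo≢hi l e = 1+n≢n (trans (sym (toℕ-hi l)) (trans (cong toℕ (sym e)) (toℕ-lo l)))

χ : ∀ {p} {P : Set p} → Dec P → ℕ
χ (yes _) = 1
χ (no _)  = 0

χ-cong : ∀ {p q} {P : Set p} {Q : Set q} → (P → Q) → (Q → P) → (d : Dec P) (e : Dec Q) → χ d ≡ χ e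
χ-cong f g (yes p) (yes q) = refl
χ-cong f g (yes p) (no ¬q) = ⊥-elim (¬q (f p))
χ-cong f g (no ¬p) (yes q) = ⊥-elim (¬p (g q))
χ-cong f g (no _)  (no _)  = refl

χ-yes : ∀ {p} {P : Set p} → P → (d : Dec P) → χ d ≡ 1
χ-yes x (yes _) = refl
χ-yes x (no ¬x) = ⊥-elim (¬x x)

χ-no : ∀ {p} {P : Set p} → ¬ P → (d : Dec P) → χ d ≡ 0
χ-no ¬x (yes x) = ⊥-elim (¬x x)
χ-no ¬x (no _)  = refl

χ≤1 : ∀ {p} {P : Set p} (d : Dec P) → χ d ≤ 1
χ≤1 (yes _) = ≤-refl
χ≤1 (no _)  = z≤n

χ-split : ∀ {p q} {P : Set p} {Q : Set q} (d : Dec P) (e : Dec Q) → χ d ≡ χ (d ×-dec e) + χ (d ×-dec ¬? e)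
χ-split (yes _) (yes _) = refl
χ-split (yes _) (no _)  = refl
χ-split (no _)  (yes _) = refl
χ-split (no _)  (no _)  = refl

sum-zero : ∀ {n} (f : Fin n → ℕ) → (∀ i → f i ≡ 0) → sum f ≡ 0
sum-zero {zero}  f f≡0 = refl
sum-zero {suc n} f f≡0 = cong₂ _+_ (f≡0 F.zero) (sum-zero (f ∘ F.suc) (f≡0 ∘ F.suc))

sum-single : ∀ {n} (f : Fin n → ℕ) e → (∀ i → i ≢ e → f i ≡ 0) → sum f ≡ f e
sum-single {suc n} f F.zero f≡0 =
  trans (cong (f F.zero +_) (sum-zero (f ∘ F.suc) (λ i → f≡0 (F.suc i) (λ ())))) (+-identityʳ _)
sum-single {suc n} f (F.suc e) f≡0 =
  trans (cong (_+ sum (f ∘ F.suc)) (f≡0 F.zero (λ ())))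
        (sum-single (f ∘ F.suc) e (λ i i≢e → f≡0 (F.suc i) (i≢e ∘ FP.suc-injective)))

sum-suc-at : ∀ {n} (f g : Fin n → ℕ) e → f e ≡ suc (g e) → (∀ i → i ≢ e → f i ≡ g i) → sum f ≡ suc (sum g)
sum-suc-at {suc n} f g F.zero fe f≡g = cong₂ _+_ fe (sum-cong-≗ (λ i → f≡g (F.suc i) (λ ())))
sum-suc-at {suc n} f g (F.suc e) fe f≡g =
  trans (cong₂ _+_ (f≡g F.zero (λ ()))
                   (sum-suc-at (f ∘ F.suc) (g ∘ F.suc) e fe (λ i i≢e → f≡g (F.suc i) (i≢e ∘ FP.suc-injective))))
        (+-suc _ _)

≤-sum : ∀ {n} (f : Fin n → ℕ) e → f e ≤ sum f
≤-sum {suc n} f F.zero    = m≤m+n _ _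
≤-sum {suc n} f (F.suc e) = ≤-trans (≤-sum (f ∘ F.suc) e) (m≤n+m _ _)

+-≤-sum : ∀ {n} (f : Fin n → ℕ) e e′ → e ≢ e′ → f e + f e′ ≤ sum f
+-≤-sum {suc n} f F.zero    F.zero     e≢e′ = ⊥-elim (e≢e′ refl)
+-≤-sum {suc n} f F.zero    (F.suc e′) e≢e′ = +-monoʳ-≤ (f F.zero) (≤-sum (f ∘ F.suc) e′)
+-≤-sum {suc n} f (F.suc e) F.zero     e≢e′ =
  subst (_≤ sum f) (+-comm (f F.zero) _) (+-monoʳ-≤ (f F.zero) (≤-sum (f ∘ F.suc) e))
+-≤-sum {suc n} f (F.suc e) (F.suc e′) e≢e′ =
  ≤-trans (+-≤-sum (f ∘ F.suc) e e′ (e≢e′ ∘ cong F.suc)) (m≤n+m _ _)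

module _ {n p} {P : Fin n → Set p} (P? : Decidable P) where

  count : ℕ
  count = sum (λ i → χ (P? i))

  count-zero : (∀ i → ¬ P i) → count ≡ 0
  count-zero ¬P = sum-zero _ (λ i → χ-no (¬P i) (P? i))

  1≤count : ∀ e → P e → 1 ≤ count
  1≤count e Pe = subst (_≤ count) (χ-yes Pe (P? e)) (≤-sum _ e)

  2≤count : ∀ e e′ → P e → P e′ → e ≢ e′ → 2 ≤ count
  2≤count e e′ Pe Pe′ e≢e′ =
    subst (_≤ count) (cong₂ _+_ (χ-yes Pe (P? e)) (χ-yes Pe′ (P? e′))) (+-≤-sum _ e e′ e≢e′)

  1≤count⇒∃ : 1 ≤ count → Σ (Fin n) P
  1≤count⇒∃ h with FP.any? P?
  ... | yes found = found
  ... | no none   = ⊥-elim (<-irrefl (sym (count-zero (λ i Pi → none (i , Pi)))) h)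

  2≤count⇒two : 2 ≤ count → Σ (Fin n) λ e → Σ (Fin n) λ e′ → P e × P e′ × e ≢ e′
  2≤count⇒two h with 1≤count⇒∃ (≤-trans (s≤s z≤n) h)
  ... | e , Pe with FP.any? (λ i → P? i ×-dec ¬? (i FP.≟ e))
  ...   | yes (e′ , Pe′ , e′≢e) = e , e′ , Pe , Pe′ , e′≢e ∘ sym
  ...   | no none = ⊥-elim (<-irrefl refl (≤-trans h (≤-trans (≤-reflexive count≡χe) (χ≤1 (P? e)))))
    where
    count≡χe : count ≡ χ (P? e)
    count≡χe = sum-single _ e (λ i i≢e → χ-no (λ Pi → none (i , Pi , i≢e)) (P? i))

count-cong : ∀ {n p q} {P : Fin n → Set p} {Q : Fin n → Set q} (P? : Decidable P) (Q? : Decidable Q) →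
             (∀ i → P i → Q i) → (∀ i → Q i → P i) → count P? ≡ count Q?
count-cong P? Q? f g = sum-cong-≗ (λ i → χ-cong (f i) (g i) (P? i) (Q? i))

count-split : ∀ {n p q} {P : Fin n → Set p} {Q : Fin n → Set q} (P? : Decidable P) (Q? : Decidable Q) →
              count P? ≡ count (λ i → P? i ×-dec Q? i) + count (λ i → P? i ×-dec ¬? (Q? i))
count-split {n} P? Q? = trans (sum-cong-≗ (λ i → χ-split (P? i) (Q? i))) (∑-distrib-+ {n} _ _)

count-permute : ∀ {n p} {P : Fin n → Set p} (P? : Decidable P) (π : Perm n) →
                count P? ≡ count (λ i → P? (π ⟨$⟩ʳ i))
count-permute P? π = sum-permute _ π

length-filter-tabulate : ∀ {n} {A : Set} {P : A → Set} (P? : Decidable P) (f : Fin n → A) →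
                         length (filter P? (tabulate f)) ≡ count (P? ∘ f)
length-filter-tabulate {zero}  P? f = refl
length-filter-tabulate {suc n} P? f with P? (f F.zero)
... | yes _ = cong suc (length-filter-tabulate P? (f ∘ F.suc))
... | no _  = length-filter-tabulate P? (f ∘ F.suc)

length-filter-cartesianProduct :
  ∀ {n m} {A B : Set} {P : A × B → Set} (P? : Decidable P) (f : Fin n → A) (g : Fin m → B) →
  length (filter P? (cartesianProduct (tabulate f) (tabulate g))) ≡ sum (λ i → count (λ j → P? (f i , g j)))
length-filter-cartesianProduct {zero}      P? f g = refl
length-filter-cartesianProduct {suc n} {m} P? f g = begin
  length (filter P? (map (f F.zero ,_) (tabulate g) ++ rest))
    ≡⟨ cong length (filter-++ P? (map (f F.zero ,_) (tabulate g)) rest) ⟩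
  length (filter P? (map (f F.zero ,_) (tabulate g)) ++ filter P? rest)
    ≡⟨ length-++ (filter P? (map (f F.zero ,_) (tabulate g))) ⟩
  length (filter P? (map (f F.zero ,_) (tabulate g))) + length (filter P? rest)
    ≡⟨ cong₂ _+_ (trans (cong (length ∘ filter P?) (map-tabulate g (f F.zero ,_)))
                         (length-filter-tabulate P? ((f F.zero ,_) ∘ g)))
                 (length-filter-cartesianProduct P? (f ∘ F.suc) g) ⟩
  sum (λ i → count (λ j → P? (f i , g j))) ∎
  where open ≡-Reasoning
        rest = cartesianProduct (tabulate (f ∘ F.suc)) (tabulate g)

val : ∀ {n} → Perm n → Fin n → ℕ
val v i = toℕ (v ⟨$⟩ʳ i)

val-injective : ∀ {n} (v : Perm n) {i j} → val v i ≡ val v j → i ≡ j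
val-injective v {i} {j} e = trans (sym (inverseˡ v)) (trans (cong (v ⟨$⟩ˡ_) (toℕ-injective e)) (inverseˡ v))

Inversion : ∀ {n} → Perm n → Fin n → Fin n → Set
Inversion v i j = toℕ i < toℕ j × val v j < val v i

inversion? : ∀ {n} (v : Perm n) i j → Dec (Inversion v i j)
inversion? v i j = (i F.<? j) ×-dec (v ⟨$⟩ʳ j F.<? v ⟨$⟩ʳ i)

ℓ≡sum-count : ∀ {n} (v : Perm n) → ℓ v ≡ sum (λ i → count (inversion? v i))
ℓ≡sum-count {n} v = length-filter-cartesianProduct {n} {n} _ (λ i → i) (λ i → i)

Inversion-cong : ∀ {n} {u v : Perm n} → u ≈ v → ∀ {i j} → Inversion u i j → Inversion v i j
Inversion-cong u≈v {i} {j} (i<j , uj<ui) = i<j , subst₂ _<_ (cong toℕ (u≈v j)) (cong toℕ (u≈v i)) uj<ui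

ℓ-cong : ∀ {n} {u v : Perm n} → u ≈ v → ℓ u ≡ ℓ v
ℓ-cong {n} {u} {v} u≈v = begin
  ℓ u                                     ≡⟨ ℓ≡sum-count u ⟩
  sum {n} (λ i → count (inversion? u i))  ≡⟨ sum-cong-≗ {n} (λ i → count-cong (inversion? u i) (inversion? v i)
                                               (λ _ → Inversion-cong {u = u} {v} u≈v)
                                               (λ _ → Inversion-cong {u = v} {u} (sym ∘ u≈v))) ⟩
  sum {n} (λ i → count (inversion? v i))  ≡⟨ ℓ≡sum-count v ⟨
  ℓ v                                     ∎
  where open ≡-Reasoning

ℓ-id : ∀ {n} → ℓ (P.id {n}) ≡ 0
ℓ-id {n} = trans (ℓ≡sum-count {n} P.id)
                 (sum-zero {n} _ (λ i → count-zero (inversion? P.id i) (λ _ (i<j , j<i) → <-asym i<j j<i)))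

val-s· : ∀ {n} (l : Letter n) (v : Perm n) i → val (s l · v) i ≡ swapℕ (proj₁ l) (val v i)
val-s· l v i = toℕ-s l (v ⟨$⟩ʳ i)

val-⟨$⟩ˡ-lo : ∀ {n} (v : Perm n) (l : Letter n) → val v (v ⟨$⟩ˡ lo l) ≡ proj₁ l
val-⟨$⟩ˡ-lo v l = trans (cong toℕ (inverseʳ v)) (toℕ-lo l)

val-⟨$⟩ˡ-hi : ∀ {n} (v : Perm n) (l : Letter n) → val v (v ⟨$⟩ˡ hi l) ≡ suc (proj₁ l)
val-⟨$⟩ˡ-hi v l = trans (cong toℕ (inverseʳ v)) (toℕ-hi l)

val≡k⇒⟨$⟩ˡ-lo : ∀ {n} (v : Perm n) (l : Letter n) {i} → val v i ≡ proj₁ l → i ≡ v ⟨$⟩ˡ lo l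
val≡k⇒⟨$⟩ˡ-lo v l e = val-injective v (trans e (sym (val-⟨$⟩ˡ-lo v l)))

val≡1+k⇒⟨$⟩ˡ-hi : ∀ {n} (v : Perm n) (l : Letter n) {i} → val v i ≡ suc (proj₁ l) → i ≡ v ⟨$⟩ˡ hi l
val≡1+k⇒⟨$⟩ˡ-hi v l e = val-injective v (trans e (sym (val-⟨$⟩ˡ-hi v l)))

val-s·-⟨$⟩ˡ-lo : ∀ {n} (l : Letter n) (v : Perm n) → val (s l · v) (v ⟨$⟩ˡ lo l) ≡ suc (proj₁ l)
val-s·-⟨$⟩ˡ-lo l v = trans (val-s· l v _) (trans (cong (swapℕ (proj₁ l)) (val-⟨$⟩ˡ-lo v l)) (swapℕ-k _))

val-s·-⟨$⟩ˡ-hi : ∀ {n} (l : Letter n) (v : Perm n) → val (s l · v) (v ⟨$⟩ˡ hi l) ≡ proj₁ l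
val-s·-⟨$⟩ˡ-hi l v = trans (val-s· l v _) (trans (cong (swapℕ (proj₁ l)) (val-⟨$⟩ˡ-hi v l)) (swapℕ-1+k _))

Ascent Descent : ∀ {n} → Perm n → Letter n → Set
Ascent  v l = toℕ (v ⟨$⟩ˡ lo l) < toℕ (v ⟨$⟩ˡ hi l)
Descent v l = toℕ (v ⟨$⟩ˡ hi l) < toℕ (v ⟨$⟩ˡ lo l)

ascent-or-descent : ∀ {n} (v : Perm n) l → Ascent v l ⊎ Descent v l
ascent-or-descent v l with <-cmp (toℕ (v ⟨$⟩ˡ lo l)) (toℕ (v ⟨$⟩ˡ hi l))
... | tri< asc _ _ = inj₁ asc
... | tri≈ _ e _   = ⊥-elim (lo≢hi l (trans (sym (inverseʳ v)) (trans (cong (v ⟨$⟩ʳ_) (toℕ-injective e)) (inverseʳ v))))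
... | tri> _ _ dsc = inj₂ dsc

descent⇒ascent-s· : ∀ {n} (v : Perm n) l → Descent v l → Ascent (s l · v) l
descent⇒ascent-s· v l = subst₂ (λ a b → toℕ (v ⟨$⟩ˡ a) < toℕ (v ⟨$⟩ˡ b))
                                (sym (trans (s⁻¹≡s l (lo l)) (s-lo l))) (sym (trans (s⁻¹≡s l (hi l)) (s-hi l)))

s·s· : ∀ {n} (l : Letter n) (v : Perm n) → s l · (s l · v) ≈ v
s·s· l v i = s-involutive l (v ⟨$⟩ʳ i)

s·-inversion⁻ : ∀ {n} (l : Letter n) (v : Perm n) {i j} → ¬ (val v i ≡ proj₁ l × val v j ≡ suc (proj₁ l)) →
                Inversion (s l · v) i j → Inversion v i j
s·-inversion⁻ l v {i} {j} ¬kk (i<j , h) =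
  i<j , swapℕ-reflects-< (proj₁ l) (subst₂ _<_ (val-s· l v j) (val-s· l v i) h) (λ (e₁ , e₂) → ¬kk (e₂ , e₁))

s·-inversion⁺ : ∀ {n} (l : Letter n) (v : Perm n) {i j} → Ascent v l → Inversion v i j → Inversion (s l · v) i j
s·-inversion⁺ l v {i} {j} asc (i<j , h) =
  i<j , subst₂ _<_ (sym (val-s· l v j)) (sym (val-s· l v i)) (swapℕ-mono-< (proj₁ l) h ¬kk)
  where
  ¬kk : ¬ (val v j ≡ proj₁ l × val v i ≡ suc (proj₁ l))
  ¬kk (e₁ , e₂) = <-asym asc (subst₂ (λ a b → toℕ a < toℕ b) (val≡1+k⇒⟨$⟩ˡ-hi v l e₂) (val≡k⇒⟨$⟩ˡ-lo v l e₁)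
                                     i<j)

ℓ-ascent : ∀ {n} (v : Perm n) l → Ascent v l → ℓ (s l · v) ≡ suc (ℓ v)
ℓ-ascent {n} v l asc = begin
  ℓ (s l · v)                                    ≡⟨ ℓ≡sum-count (s l · v) ⟩
  sum {n} (λ i → count (inversion? (s l · v) i)) ≡⟨ sum-suc-at _ _ a row-a other-rows ⟩
  suc (sum {n} (λ i → count (inversion? v i)))   ≡⟨ cong suc (ℓ≡sum-count v) ⟨
  suc (ℓ v)                                      ∎
  where
  open ≡-Reasoning
  k = proj₁ l
  a = v ⟨$⟩ˡ lo l
  b = v ⟨$⟩ˡ hi l
  same : ∀ i j → ¬ (i ≡ a × j ≡ b) → χ (inversion? (s l · v) i j) ≡ χ (inversion? v i j)
  same i j ¬ab = χ-cong (s·-inversion⁻ l v λ (e₁ , e₂) → ¬ab (val≡k⇒⟨$⟩ˡ-lo v l e₁ , val≡1+k⇒⟨$⟩ˡ-hi v l e₂))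
                        (s·-inversion⁺ l v asc) _ _
  new : Inversion (s l · v) a b
  new = asc , subst₂ _<_ (sym (val-s·-⟨$⟩ˡ-hi l v)) (sym (val-s·-⟨$⟩ˡ-lo l v)) (n<1+n k)
  old : ¬ Inversion v a b
  old (_ , h) = <-asym (n<1+n k) (subst₂ _<_ (val-⟨$⟩ˡ-hi v l) (val-⟨$⟩ˡ-lo v l) h)
  row-a : count (inversion? (s l · v) a) ≡ suc (count (inversion? v a))
  row-a = sum-suc-at _ _ b (trans (χ-yes new _) (cong suc (sym (χ-no old _))))
                     (λ j j≢b → same a j (j≢b ∘ proj₂))
  other-rows : ∀ i → i ≢ a → count (inversion? (s l · v) i) ≡ count (inversion? v i)
  other-rows i i≢a = sum-cong-≗ {n} (λ j → same i j (i≢a ∘ proj₁))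

ℓ-descent : ∀ {n} (v : Perm n) l → Descent v l → ℓ v ≡ suc (ℓ (s l · v))
ℓ-descent v l dsc = trans (sym (ℓ-cong {u = s l · (s l · v)} {v} (s·s· l v)))
                          (ℓ-ascent (s l · v) l (descent⇒ascent-s· v l dsc))

ℓ-s·≤ : ∀ {n} (l : Letter n) (v : Perm n) → ℓ (s l · v) ≤ suc (ℓ v)
ℓ-s·≤ l v with ascent-or-descent v l
... | inj₁ asc = ≤-reflexive (ℓ-ascent v l asc)
... | inj₂ dsc = m≤n⇒m≤1+n (≤-trans (n≤1+n _) (≤-reflexive (sym (ℓ-descent v l dsc))))

ℓ-prod≤length : ∀ {n} (ws : List (Letter n)) → ℓ (prod ws) ≤ length ws
ℓ-prod≤length {n} []  = ≤-reflexive (ℓ-id {n})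
ℓ-prod≤length (l ∷ ws) = ≤-trans (ℓ-s·≤ l (prod ws)) (s≤s (ℓ-prod≤length ws))

letter-≡ : ∀ {n k m} (p : suc k < n) (q : suc m < n) → k ≡ m → _≡_ {A = Letter n} (k , p) (m , q)
letter-≡ p q refl = cong (_ ,_) (<-irrelevant p q)

letter-search : ∀ {n q} {Q : Letter n → Set q} → (∀ l → Dec (Q l)) → Σ (Letter n) Q ⊎ (∀ l → ¬ Q l)
letter-search {n} {Q = Q} Q? = decide (FP.any? Q-at?)
  where
  Q-at : Fin n → Set _
  Q-at i = Σ (suc (toℕ i) < n) λ p → Q (toℕ i , p)
  Q-at? : Decidable Q-at
  Q-at? i with suc (toℕ i) ℕ.<? n
  ... | no ¬p = no (¬p ∘ proj₁)
  ... | yes p with Q? (toℕ i , p)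
  ...   | yes q = yes (p , q)
  ...   | no ¬q = no (λ (p′ , q) → ¬q (subst Q (letter-≡ p′ p refl) q))
  Q-at-lo : ∀ l → Q l → Q-at (lo l)
  Q-at-lo (k , p) q = subst (λ m → suc m < n) (sym (toℕ-lo (k , p))) p ,
                      subst Q (letter-≡ p _ (sym (toℕ-lo (k , p)))) q
  decide : Dec (Σ (Fin n) Q-at) → Σ (Letter n) Q ⊎ (∀ l → ¬ Q l)
  decide (yes (_ , _ , q)) = inj₁ (_ , q)
  decide (no none)         = inj₂ (λ l q → none (lo l , Q-at-lo l q))

no-descent⇒≈id : ∀ {n} (v : Perm n) → (∀ l → ¬ Descent v l) → v ≈ P.id
no-descent⇒≈id {n} v no-dsc i = fixed n i (FP.toℕ<n i)
  where
  ascent : ∀ l → Ascent v l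
  ascent l = [ (λ asc → asc) , (λ dsc → ⊥-elim (no-dsc l dsc)) ]′ (ascent-or-descent v l)
  k≤v⁻¹k : ∀ k (p : k < n) → k ≤ toℕ (v ⟨$⟩ˡ fromℕ< p)
  k≤v⁻¹k zero    p = z≤n
  k≤v⁻¹k (suc k) p = ≤-trans (s≤s (k≤v⁻¹k k (<-trans (n<1+n k) p))) (ascent (k , p))
  val≤ : ∀ i → val v i ≤ toℕ i
  val≤ i = subst (λ j → val v i ≤ toℕ j)
                 (trans (cong (v ⟨$⟩ˡ_) (FP.fromℕ<-toℕ (v ⟨$⟩ʳ i) (FP.toℕ<n _))) (inverseˡ v))
                 (k≤v⁻¹k (val v i) (FP.toℕ<n _))
  fixed : ∀ m i → toℕ i < m → v ⟨$⟩ʳ i ≡ i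
  fixed (suc m) i i<1+m with m≤n⇒m<n∨m≡n (val≤ i)
  ... | inj₂ e = toℕ-injective e
  ... | inj₁ vi<i = ⊥-elim (<-irrefl (cong toℕ (val-injective v (cong toℕ vvi≡vi))) vi<i)
    where
    vvi≡vi : v ⟨$⟩ʳ (v ⟨$⟩ʳ i) ≡ v ⟨$⟩ʳ i
    vvi≡vi = fixed m (v ⟨$⟩ʳ i) (<-≤-trans vi<i (≤-pred i<1+m))

descent? : ∀ {n} (v : Perm n) → Σ (Letter n) (Descent v) ⊎ (∀ l → ¬ Descent v l)
descent? v = letter-search (λ l → toℕ (v ⟨$⟩ˡ hi l) ℕ.<? toℕ (v ⟨$⟩ˡ lo l))

descent-induction : ∀ {n p} (P : Perm n → Set p) → (∀ v → v ≈ P.id → P v) →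
                    (∀ v l → Descent v l → P (s l · v) → P v) → ∀ v → P v
descent-induction {n} P base step v = go (ℓ v) v refl
  where
  go : ∀ m v → ℓ v ≡ m → P v
  go m v ℓv≡m with descent? v
  ... | inj₂ none = base v (no-descent⇒≈id v none)
  go zero    v ℓv≡0   | inj₁ (l , dsc) = ⊥-elim (1+n≢0 (trans (sym (ℓ-descent v l dsc)) ℓv≡0))
  go (suc m) v ℓv≡1+m | inj₁ (l , dsc) =
    step v l dsc (go m (s l · v) (suc-injective (trans (sym (ℓ-descent v l dsc)) ℓv≡1+m)))

reducedWord : ∀ {n} (v : Perm n) → Σ (List (Letter n)) (IsReducedWord v)
reducedWord {n} = descent-induction (λ v → Σ (List (Letter n)) (IsReducedWord v)) base step
  where
  base : ∀ v → v ≈ P.id → Σ (List (Letter n)) (IsReducedWord v)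
  base v v≈id = [] , sym ∘ v≈id , trans (sym (ℓ-id {n})) (ℓ-cong {u = P.id} {v} (sym ∘ v≈id))
  step : ∀ v l → Descent v l → Σ (List (Letter n)) (IsReducedWord (s l · v)) → Σ (List (Letter n)) (IsReducedWord v)
  step v l dsc (ws , prod≈ , len) = l ∷ ws , (λ i → trans (cong (s l ⟨$⟩ʳ_) (prod≈ i)) (s-involutive l _)) ,
                                    trans (cong suc len) (sym (ℓ-descent v l dsc))

prod-++ : ∀ {n} (xs ys : List (Letter n)) → prod (xs ++ ys) ≈ prod xs · prod ys
prod-++ []       ys i = refl
prod-++ (l ∷ xs) ys i = cong (s l ⟨$⟩ʳ_) (prod-++ xs ys i)

flip-cong : ∀ {n} {u v : Perm n} → u ≈ v → flip u ≈ flip v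
flip-cong {n} {u} {v} u≈v i = trans (cong (u ⟨$⟩ˡ_) (sym (trans (u≈v (v ⟨$⟩ˡ i)) (inverseʳ v)))) (inverseˡ u)

prod-reverse : ∀ {n} (ws : List (Letter n)) → prod (reverse ws) ≈ flip (prod ws)
prod-reverse []       i = refl
prod-reverse (l ∷ ws) i = begin
  prod (reverse (l ∷ ws)) ⟨$⟩ʳ i     ≡⟨ cong (λ xs → prod xs ⟨$⟩ʳ i) (unfold-reverse l ws) ⟩
  prod (reverse ws ∷ʳ l) ⟨$⟩ʳ i      ≡⟨ prod-++ (reverse ws) (l ∷ []) i ⟩
  prod (reverse ws) ⟨$⟩ʳ (s l ⟨$⟩ʳ i) ≡⟨ prod-reverse ws (s l ⟨$⟩ʳ i) ⟩
  prod ws ⟨$⟩ˡ (s l ⟨$⟩ʳ i)           ≡⟨ cong (prod ws ⟨$⟩ˡ_) (s⁻¹≡s l i) ⟨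
  flip (prod (l ∷ ws)) ⟨$⟩ʳ i        ∎
  where open ≡-Reasoning

ℓ-flip≤ : ∀ {n} (v : Perm n) → ℓ (flip v) ≤ ℓ v
ℓ-flip≤ v with reducedWord v
... | ws , prod≈v , len = begin
  ℓ (flip v)             ≡⟨ ℓ-cong {u = flip v} {prod (reverse ws)}
                              (λ i → sym (trans (prod-reverse ws i) (flip-cong {u = prod ws} {v} prod≈v i))) ⟩
  ℓ (prod (reverse ws))  ≤⟨ ℓ-prod≤length (reverse ws) ⟩
  length (reverse ws)    ≡⟨ trans (length-reverse ws) len ⟩
  ℓ v                    ∎
  where open ≤-Reasoning

ℓ-flip : ∀ {n} (v : Perm n) → ℓ (flip v) ≡ ℓ v
ℓ-flip v = ≤-antisym (ℓ-flip≤ v) (ℓ-flip≤ (flip v))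

ℓ-·s : ∀ {n} (v : Perm n) l → val v (lo l) < val v (hi l) → ℓ (v · s l) ≡ suc (ℓ v)
ℓ-·s v l asc = begin
  ℓ (v · s l)            ≡⟨ ℓ-flip (v · s l) ⟨
  ℓ (flip (v · s l))     ≡⟨ ℓ-cong {u = flip (v · s l)} {s l · flip v} (λ i → s⁻¹≡s l (v ⟨$⟩ˡ i)) ⟩
  ℓ (s l · flip v)       ≡⟨ ℓ-ascent (flip v) l asc ⟩
  suc (ℓ (flip v))       ≡⟨ cong suc (ℓ-flip v) ⟩
  suc (ℓ v)              ∎
  where open ≡-Reasoning

CrossesUp CrossesDown : ∀ {n} → Perm n → ℕ → Fin n → Set
CrossesUp   v k p = toℕ p ≤ k × k < val v p
CrossesDown v k q = k < toℕ q × val v q ≤ k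

crossesUp? : ∀ {n} (v : Perm n) k → Decidable (CrossesUp v k)
crossesUp? v k p = (toℕ p ℕ.≤? k) ×-dec (k ℕ.<? val v p)

crossesDown? : ∀ {n} (v : Perm n) k → Decidable (CrossesDown v k)
crossesDown? v k q = (k ℕ.<? toℕ q) ×-dec (val v q ℕ.≤? k)

-- v moves some position across the cut between k and k+1; this is k ∈ supp v (InSupp⇒Crossed, Crossed⇒InSupp).
Crossed : ∀ {n} → Perm n → ℕ → Set
Crossed {n} v k = Σ (Fin n) (CrossesUp v k)

-- Both counts complement the positions p ≤ k with v p ≤ k, in {p ≤ k} and in {p | v p ≤ k} respectively,
-- and these two sets are equinumerous.
count-crossesUp≡count-crossesDown : ∀ {n} (v : Perm n) k → count (crossesUp? v k) ≡ count (crossesDown? v k)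
count-crossesUp≡count-crossesDown {n} v k = +-cancelˡ-≡ (count both?) _ _ (begin
  count both? + count (crossesUp? v k)
    ≡⟨ cong (count both? +_) (count-cong (crossesUp? v k) (λ p → pos≤? p ×-dec ¬? (val≤? p))
                                         (λ _ (a , b) → a , <⇒≱ b) (λ _ (a , b) → a , ≰⇒> b)) ⟩
  count both? + count (λ p → pos≤? p ×-dec ¬? (val≤? p))
    ≡⟨ count-split pos≤? val≤? ⟨
  count pos≤?
    ≡⟨ count-permute pos≤? v ⟩
  count val≤?
    ≡⟨ count-split val≤? pos≤? ⟩
  count (λ p → val≤? p ×-dec pos≤? p) + count (λ p → val≤? p ×-dec ¬? (pos≤? p))
    ≡⟨ cong₂ _+_ (count-cong (λ p → val≤? p ×-dec pos≤? p) both? (λ _ (a , b) → b , a) (λ _ (a , b) → b , a))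
                 (count-cong (λ p → val≤? p ×-dec ¬? (pos≤? p)) (crossesDown? v k)
                             (λ _ (a , b) → ≰⇒> b , a) (λ _ (a , b) → b , <⇒≱ a)) ⟩
  count both? + count (crossesDown? v k)
    ∎)
  where
  open ≡-Reasoning
  pos≤? = λ (p : Fin n) → toℕ p ℕ.≤? k
  val≤? = λ (p : Fin n) → val v p ℕ.≤? k
  both? = λ (p : Fin n) → pos≤? p ×-dec val≤? p

crossesDown⇒Crossed : ∀ {n} (v : Perm n) {k} q → CrossesDown v k q → Crossed v k
crossesDown⇒Crossed v {k} q h =
  1≤count⇒∃ (crossesUp? v k) (subst (1 ≤_) (sym (count-crossesUp≡count-crossesDown v k)) (1≤count (crossesDown? v k) q h))

Crossed⇒crossesDown : ∀ {n} (v : Perm n) {k} → Crossed v k → Σ (Fin n) (CrossesDown v k)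
Crossed⇒crossesDown v {k} (p , h) =
  1≤count⇒∃ (crossesDown? v k) (subst (1 ≤_) (count-crossesUp≡count-crossesDown v k) (1≤count (crossesUp? v k) p h))

two-crossesUp⇒two-crossesDown : ∀ {n} (v : Perm n) {k} p p′ → CrossesUp v k p → CrossesUp v k p′ → p ≢ p′ →
  Σ (Fin n) λ q → Σ (Fin n) λ q′ → CrossesDown v k q × CrossesDown v k q′ × q ≢ q′
two-crossesUp⇒two-crossesDown v {k} p p′ h h′ p≢p′ = 2≤count⇒two (crossesDown? v k)
  (subst (2 ≤_) (count-crossesUp≡count-crossesDown v k) (2≤count (crossesUp? v k) p p′ h h′ p≢p′))

two-crossesDown⇒two-crossesUp : ∀ {n} (v : Perm n) {k} q q′ → CrossesDown v k q → CrossesDown v k q′ → q ≢ q′ →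
  Σ (Fin n) λ p → Σ (Fin n) λ p′ → CrossesUp v k p × CrossesUp v k p′ × p ≢ p′
two-crossesDown⇒two-crossesUp v {k} q q′ h h′ q≢q′ = 2≤count⇒two (crossesUp? v k)
  (subst (2 ≤_) (sym (count-crossesUp≡count-crossesDown v k)) (2≤count (crossesDown? v k) q q′ h h′ q≢q′))

Crossed-cong : ∀ {n} {u v : Perm n} {k} → u ≈ v → Crossed u k → Crossed v k
Crossed-cong u≈v (p , p≤k , k<up) = p , p≤k , subst (λ t → _ < toℕ t) (u≈v p) k<up

¬Crossed-id : ∀ {n} k → ¬ Crossed (P.id {n}) k
¬Crossed-id k (p , p≤k , k<p) = <-irrefl refl (≤-<-trans p≤k k<p)

Crossed-s·⇒ : ∀ {n} (l : Letter n) (v : Perm n) {j} → j ≢ proj₁ l → Crossed (s l · v) j → Crossed v j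
Crossed-s·⇒ l v j≢k (p , p≤j , j<) = p , p≤j , proj₁ (swapℕ-cut (val v p) j≢k) (subst (_ <_) (val-s· l v p) j<)

Crossed-s·⇐ : ∀ {n} (l : Letter n) (v : Perm n) {j} → j ≢ proj₁ l → Crossed v j → Crossed (s l · v) j
Crossed-s·⇐ l v j≢k (p , p≤j , j<) = p , p≤j , subst (_ <_) (sym (val-s· l v p)) (proj₂ (swapℕ-cut (val v p) j≢k) j<)

-- s l · v moves the value k+1 to position v⁻¹(k) and k to v⁻¹(k+1); one of the two crosses the cut at k.
ascent⇒Crossed-s· : ∀ {n} (l : Letter n) (v : Perm n) → Ascent v l → Crossed (s l · v) (proj₁ l)
ascent⇒Crossed-s· l v asc with toℕ (v ⟨$⟩ˡ lo l) ℕ.≤? proj₁ l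
... | yes a≤k = v ⟨$⟩ˡ lo l , a≤k , subst (proj₁ l <_) (sym (val-s·-⟨$⟩ˡ-lo l v)) (n<1+n _)
... | no a≰k  = crossesDown⇒Crossed (s l · v) (v ⟨$⟩ˡ hi l)
                  (<-trans (≰⇒> a≰k) asc , ≤-reflexive (val-s·-⟨$⟩ˡ-hi l v))

Reduced : ∀ {n} → List (Letter n) → Set
Reduced ws = ℓ (prod ws) ≡ length ws

reduced-tail : ∀ {n} (l : Letter n) ws → Reduced (l ∷ ws) → Reduced ws × Ascent (prod ws) l
reduced-tail l ws red with ascent-or-descent (prod ws) l
... | inj₁ asc = suc-injective (trans (sym (ℓ-ascent (prod ws) l asc)) red) , asc
... | inj₂ dsc = ⊥-elim (<-irrefl refl (≤-trans (n≤1+n _)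
                   (subst (_≤ length ws) (trans (ℓ-descent (prod ws) l dsc) (cong suc red)) (ℓ-prod≤length ws))))

reduced-letter⇒Crossed : ∀ {n} (ws : List (Letter n)) {k} → Reduced ws → k ∈ map proj₁ ws → Crossed (prod ws) k
reduced-letter⇒Crossed (l ∷ ws) {k} red k∈ with reduced-tail l ws red | k ℕ.≟ proj₁ l
... | _    , asc | yes refl = ascent⇒Crossed-s· l (prod ws) asc
... | red′ , _   | no k≢l with k∈
...   | here k≡l  = ⊥-elim (k≢l k≡l)
...   | there k∈′ = Crossed-s·⇐ l (prod ws) k≢l (reduced-letter⇒Crossed ws red′ k∈′)

Crossed-prod⇒letter : ∀ {n} (ws : List (Letter n)) {k} → Crossed (prod ws) k → k ∈ map proj₁ ws
Crossed-prod⇒letter []       {k} c = ⊥-elim (¬Crossed-id k c)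
Crossed-prod⇒letter (l ∷ ws) {k} c with k ℕ.≟ proj₁ l
... | yes k≡l = here k≡l
... | no k≢l  = there (Crossed-prod⇒letter ws (Crossed-s·⇒ l (prod ws) k≢l c))

InSupp⇒Crossed : ∀ {n} (v : Perm n) {k} → InSupp v k → Crossed v k
InSupp⇒Crossed v (ws , (prod≈v , len) , k∈) =
  Crossed-cong {u = prod ws} {v} prod≈v (reduced-letter⇒Crossed ws (trans (ℓ-cong {u = prod ws} {v} prod≈v) (sym len)) k∈)

Crossed⇒InSupp : ∀ {n} (v : Perm n) {k} → Crossed v k → InSupp v k
Crossed⇒InSupp v c with reducedWord v
... | ws , prod≈v , len = ws , (prod≈v , len) , Crossed-prod⇒letter ws (Crossed-cong {u = v} {prod ws} (sym ∘ prod≈v) c)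

-- Inclusion of (position) inversion sets: the left weak order, u ≤ᴸ x iff x = y · u with ℓ x = ℓ y + ℓ u.
infix 4 _≤ᴸ_
_≤ᴸ_ : ∀ {n} → Perm n → Perm n → Set
u ≤ᴸ x = ∀ {i j} → Inversion u i j → Inversion x i j

≤ᴸ-trans : ∀ {n} {u v w : Perm n} → u ≤ᴸ v → v ≤ᴸ w → u ≤ᴸ w
≤ᴸ-trans u≤v v≤w = v≤w ∘ u≤v

≤ᴸ-respʳ-≈ : ∀ {n} {u v w : Perm n} → v ≈ w → u ≤ᴸ v → u ≤ᴸ w
≤ᴸ-respʳ-≈ {v = v} {w} v≈w u≤v = Inversion-cong {u = v} {w} v≈w ∘ u≤v

≤ᴸ-respˡ-≈ : ∀ {n} {u v w : Perm n} → u ≈ v → u ≤ᴸ w → v ≤ᴸ w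
≤ᴸ-respˡ-≈ {u = u} {v} u≈v u≤w = u≤w ∘ Inversion-cong {u = v} {u} (sym ∘ u≈v)

descent⇒s·≤ᴸ : ∀ {n} (v : Perm n) l → Descent v l → s l · v ≤ᴸ v
descent⇒s·≤ᴸ v l dsc = ≤ᴸ-respʳ-≈ {u = s l · v} {s l · (s l · v)} {v} (s·s· l v)
                          (s·-inversion⁺ l (s l · v) (descent⇒ascent-s· v l dsc))

reduced-suffix-≤ᴸ : ∀ {n} (vs us : List (Letter n)) → Reduced (vs ++ us) → prod us ≤ᴸ prod (vs ++ us)
reduced-suffix-≤ᴸ []       us red = λ inv → inv
reduced-suffix-≤ᴸ (l ∷ vs) us red with reduced-tail l (vs ++ us) red
... | red′ , asc = ≤ᴸ-trans {u = prod us} {prod (vs ++ us)} {s l · prod (vs ++ us)}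
                             (reduced-suffix-≤ᴸ vs us red′) (s·-inversion⁺ l (prod (vs ++ us)) asc)

≤ᴸ⇒ℓ-additive : ∀ {n} (u x : Perm n) → u ≤ᴸ x → ℓ x ≡ ℓ u + ℓ (x · flip u)
≤ᴸ⇒ℓ-additive {n} = descent-induction (λ u → ∀ x → u ≤ᴸ x → ℓ x ≡ ℓ u + ℓ (x · flip u)) base step
  where
  base : ∀ u → u ≈ P.id → ∀ x → u ≤ᴸ x → ℓ x ≡ ℓ u + ℓ (x · flip u)
  base u u≈id x _ = cong₂ _+_ (sym (trans (ℓ-cong {u = u} {P.id} u≈id) (ℓ-id {n})))
                              (ℓ-cong {u = x} {x · flip u} (λ i → cong (x ⟨$⟩ʳ_) (sym (flip-cong {u = u} {P.id} u≈id i))))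
  step : ∀ u l → Descent u l → (∀ x → s l · u ≤ᴸ x → ℓ x ≡ ℓ (s l · u) + ℓ (x · flip (s l · u))) →
         ∀ x → u ≤ᴸ x → ℓ x ≡ ℓ u + ℓ (x · flip u)
  step u l dsc ih x u≤x = begin
    ℓ x                             ≡⟨ ih x (≤ᴸ-trans {u = s l · u} {u} {x} (descent⇒s·≤ᴸ u l dsc) u≤x) ⟩
    ℓ (s l · u) + ℓ (x · flip (s l · u))
                                    ≡⟨ cong (ℓ (s l · u) +_) (ℓ-cong {u = x · flip (s l · u)} {z · s l}
                                         (λ i → cong (λ t → x ⟨$⟩ʳ (u ⟨$⟩ˡ t)) (s⁻¹≡s l i))) ⟩
    ℓ (s l · u) + ℓ (z · s l)       ≡⟨ cong (ℓ (s l · u) +_) (ℓ-·s z l z-asc) ⟩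
    ℓ (s l · u) + suc (ℓ z)         ≡⟨ +-suc _ _ ⟩
    suc (ℓ (s l · u)) + ℓ z         ≡⟨ cong (_+ ℓ z) (ℓ-descent u l dsc) ⟨
    ℓ u + ℓ z                       ∎
    where
    open ≡-Reasoning
    z = x · flip u
    -- (u⁻¹(k+1), u⁻¹(k)) is an inversion of u, hence of x
    z-asc : val z (lo l) < val z (hi l)
    z-asc = proj₂ (u≤x (dsc , subst₂ _<_ (sym (val-⟨$⟩ˡ-lo u l)) (sym (val-⟨$⟩ˡ-hi u l)) (n<1+n _)))

boolean-id : ∀ {n} → Boolean (P.id {n})
boolean-id = (λ (_ , _ , _ , _ , j<m , m<j , _) → <-asym j<m m<j)
           , (λ (_ , _ , _ , _ , i<j , j<m , m<o , _ , o<i , _) → <-asym (<-trans i<j (<-trans j<m m<o)) o<i)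

≤ᴸ-FullyCommutative : ∀ {n} {u x : Perm n} → u ≤ᴸ x → FullyCommutative x → FullyCommutative u
≤ᴸ-FullyCommutative u≤x fc (i , j , m , i<j , j<m , um<uj , uj<ui) =
  fc (i , j , m , i<j , j<m , proj₂ (u≤x (j<m , um<uj)) , proj₂ (u≤x (i<j , uj<ui)))

toℕ-inverseʳ-< : ∀ {n} (u : Perm n) {i j} → toℕ i < toℕ j →
                 toℕ (u ⟨$⟩ʳ (u ⟨$⟩ˡ i)) < toℕ (u ⟨$⟩ʳ (u ⟨$⟩ˡ j))
toℕ-inverseʳ-< u = subst₂ (λ a b → toℕ a < toℕ b) (sym (inverseʳ u)) (sym (inverseʳ u))

Contains321-flip : ∀ {n} (u : Perm n) → Contains321 (flip u) → Contains321 u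
Contains321-flip u (i , j , m , i<j , j<m , a , b) =
  u ⟨$⟩ˡ m , u ⟨$⟩ˡ j , u ⟨$⟩ˡ i , a , b , toℕ-inverseʳ-< u i<j , toℕ-inverseʳ-< u j<m

Contains3412-flip : ∀ {n} (u : Perm n) → Contains3412 (flip u) → Contains3412 u
Contains3412-flip u (i , j , m , o , i<j , j<m , m<o , a , b , c) =
  u ⟨$⟩ˡ m , u ⟨$⟩ˡ o , u ⟨$⟩ˡ i , u ⟨$⟩ˡ j , a , b , c ,
  toℕ-inverseʳ-< u i<j , toℕ-inverseʳ-< u j<m , toℕ-inverseʳ-< u m<o

Boolean-flip : ∀ {n} (u : Perm n) → Boolean u → Boolean (flip u)
Boolean-flip u (¬321 , ¬3412) = ¬321 ∘ Contains321-flip u , ¬3412 ∘ Contains3412-flip u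

Crossed-flip : ∀ {n} (v : Perm n) {k} → Crossed v k → Crossed (flip v) k
Crossed-flip v (p , p≤k , k<vp) =
  crossesDown⇒Crossed (flip v) (v ⟨$⟩ʳ p) (k<vp , subst (λ t → toℕ t ≤ _) (sym (inverseˡ v)) p≤k)

<-or-> : ∀ {n} {i j : Fin n} → i ≢ j → toℕ i < toℕ j ⊎ toℕ j < toℕ i
<-or-> {i = i} {j} i≢j with <-cmp (toℕ i) (toℕ j)
... | tri< i<j _ _ = inj₁ i<j
... | tri≈ _ e _   = ⊥-elim (i≢j (toℕ-injective e))
... | tri> _ _ j<i = inj₂ j<i

val-<-or-> : ∀ {n} (u : Perm n) {i j} → toℕ i < toℕ j → val u i < val u j ⊎ val u j < val u i
val-<-or-> u i<j = <-or-> (λ e → <-irrefl (cong toℕ (val-injective u (cong toℕ e))) i<j)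

pred< : ∀ {a t} → a < t → ℕ.pred t < t
pred< {t = suc t} _ = n<1+n t

pred<⇒≤ : ∀ {a t q} → a < t → ℕ.pred t < q → t ≤ q
pred<⇒≤ {t = suc t} _ h = h

fixedPoint⇒¬Crossed : ∀ {n} (u : Perm n) → FullyCommutative u → ∀ m → val u m ≡ toℕ m → ¬ Crossed u (toℕ m)
fixedPoint⇒¬Crossed u fc m fix c@(p , p≤m , m<up) with Crossed⇒crossesDown u c
... | q , m<q , uq≤m = fc (p , m , q , p<m , m<q , uq<um , subst (_< val u p) (sym fix) m<up)
  where
  p<m : toℕ p < toℕ m
  p<m = ≤∧≢⇒< p≤m (λ e → <-irrefl (sym fix) (subst (λ t → toℕ m < val u t) (toℕ-injective e) m<up))
  uq<um : val u q < val u m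
  uq<um = ≤∧≢⇒< (subst (_ ≤_) (sym fix) uq≤m) (λ e → <-irrefl (cong toℕ (val-injective u (sym e))) m<q)

fixedPoint-Crossed-pred : ∀ {n} (u : Perm n) m → val u m ≡ toℕ m → 0 < toℕ m →
                          Crossed u (ℕ.pred (toℕ m)) → Crossed u (toℕ m)
fixedPoint-Crossed-pred u m fix 0<m (p , p≤ , <up) = p , <⇒≤ p<m , ≤∧≢⇒< (pred<⇒≤ 0<m <up) m≢up
  where
  p<m = ≤-<-trans p≤ (pred< 0<m)
  m≢up : toℕ m ≢ val u p
  m≢up e = <-irrefl (cong toℕ (val-injective u (trans (sym e) (sym fix)))) p<m

¬boolean-two-crossings : ∀ {n} (u : Perm n) {k p p′ q q′} → Boolean u → toℕ p < toℕ p′ → toℕ q < toℕ q′ →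
  CrossesUp u k p → CrossesUp u k p′ → CrossesDown u k q → CrossesDown u k q′ → ⊥
¬boolean-two-crossings u {p = p} {p′} {q} {q′} (¬321 , ¬3412) p<p′ q<q′
                       (_ , k<up) (p′≤k , k<up′) (k<q , uq≤k) (_ , uq′≤k) with val-<-or-> u p<p′
... | inj₂ up′<up = ¬321 (p , p′ , q , p<p′ , p′<q , ≤-<-trans uq≤k k<up′ , up′<up)
  where p′<q = ≤-<-trans p′≤k k<q
... | inj₁ up<up′ with val-<-or-> u q<q′
...   | inj₂ uq′<uq = ¬321 (p , q , q′ , <-trans p<p′ (≤-<-trans p′≤k k<q) , q<q′ , uq′<uq , ≤-<-trans uq≤k k<up)
...   | inj₁ uq<uq′ = ¬3412 (p , p′ , q , q′ , p<p′ , ≤-<-trans p′≤k k<q , q<q′ ,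
                              uq<uq′ , ≤-<-trans uq′≤k k<up , up<up′)

boolean⇒crossesUp-unique : ∀ {n} (u : Perm n) {k p p′} → Boolean u → CrossesUp u k p → CrossesUp u k p′ → p ≡ p′
boolean⇒crossesUp-unique u {k} {p} {p′} bu hp hp′ with p FP.≟ p′
... | yes p≡p′ = p≡p′
... | no p≢p′ with two-crossesUp⇒two-crossesDown u p p′ hp hp′ p≢p′
...   | q , q′ , hq , hq′ , q≢q′ =
  [ (λ p<p′ → ordered p<p′ hp hp′) , (λ p′<p → ordered p′<p hp′ hp) ]′ (<-or-> p≢p′)
  where
  ordered : ∀ {a b} → toℕ a < toℕ b → CrossesUp u k a → CrossesUp u k b → p ≡ p′
  ordered a<b ha hb = ⊥-elim ([ (λ q<q′ → ¬boolean-two-crossings u bu a<b q<q′ ha hb hq hq′)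
                              , (λ q′<q → ¬boolean-two-crossings u bu a<b q′<q ha hb hq′ hq) ]′ (<-or-> q≢q′))

boolean⇒crossesDown-unique : ∀ {n} (u : Perm n) {k q q′} → Boolean u → CrossesDown u k q → CrossesDown u k q′ → q ≡ q′
boolean⇒crossesDown-unique u {k} {q} {q′} bu hq hq′ with q FP.≟ q′
... | yes q≡q′ = q≡q′
... | no q≢q′ with two-crossesDown⇒two-crossesUp u q q′ hq hq′ q≢q′
...   | p , p′ , hp , hp′ , p≢p′ = ⊥-elim (p≢p′ (boolean⇒crossesUp-unique u bu hp hp′))

excedance-covers-deficiencies : ∀ {n} (u : Perm n) → Boolean u → ∀ {i j} →
                                toℕ i < toℕ j → toℕ j < val u i → val u j < toℕ j
excedance-covers-deficiencies u bu {i} {j} i<j j<ui with <-cmp (val u j) (toℕ j)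
... | tri< uj<j _ _ = uj<j
... | tri≈ _ fix _  = ⊥-elim (fixedPoint⇒¬Crossed u (proj₁ bu) j fix (i , <⇒≤ i<j , j<ui))
... | tri> _ _ j<uj = ⊥-elim (<-irrefl (cong toℕ (boolean⇒crossesUp-unique u bu (<⇒≤ i<j , j<ui) (≤-refl , j<uj))) i<j)

deficiency-covers-excedances : ∀ {n} (u : Perm n) → Boolean u → ∀ {i j} →
                               val u i < toℕ j → toℕ j < toℕ i → toℕ j < val u j
deficiency-covers-excedances u bu {i} {j} ui<j j<i with <-cmp (val u j) (toℕ j)
... | tri> _ _ j<uj = j<uj
... | tri≈ _ fix _  = ⊥-elim (fixedPoint⇒¬Crossed u (proj₁ bu) j fix (crossesDown⇒Crossed u i (j<i , <⇒≤ ui<j)))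
... | tri< uj<j _ _ = ⊥-elim (<-irrefl (cong toℕ (sym i≡j)) j<i)
  where
  i≡j = boolean⇒crossesDown-unique u bu (<-trans (pred< ui<j) j<i , <⇒≤pred ui<j) (pred< ui<j , <⇒≤pred uj<j)

excedance-value-excedance : ∀ {n} (u : Perm n) → Boolean u → ∀ {i} →
                            toℕ i < val u i → Crossed u (val u i) → val u i < val u (u ⟨$⟩ʳ i)
excedance-value-excedance u bu {i} i<ui (p , p≤ui , ui<up) with <-cmp (val u (u ⟨$⟩ʳ i)) (val u i)
... | tri> _ _ ui<uui = ui<uui
... | tri≈ _ e _      = ⊥-elim (<-irrefl (cong toℕ (sym (val-injective u e))) i<ui)
... | tri< uui<ui _ _ = ⊥-elim (<-irrefl (cong (val u) (sym p≡i)) ui<up)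
  where
  p<ui : toℕ p < val u i
  p<ui = ≤∧≢⇒< p≤ui (λ e → <-asym uui<ui (subst (λ t → val u i < val u t) (toℕ-injective e) ui<up))
  p≡i = boolean⇒crossesUp-unique u bu (<⇒≤pred p<ui , <-≤-trans (pred< i<ui) (<⇒≤ ui<up)) (<⇒≤pred i<ui , pred< i<ui)

deficiency-value-deficiency : ∀ {n} (u : Perm n) → Boolean u → ∀ {i} → val u i < toℕ i → 0 < val u i →
                              Crossed u (ℕ.pred (val u i)) → val u (u ⟨$⟩ʳ i) < val u i
deficiency-value-deficiency u bu {i} ui<i 0<ui c with <-cmp (val u (u ⟨$⟩ʳ i)) (val u i)
... | tri< uui<ui _ _ = uui<ui
... | tri≈ _ e _      = ⊥-elim (<-irrefl (cong toℕ (val-injective u e)) ui<i)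
... | tri> _ _ ui<uui with Crossed⇒crossesDown u c
...   | q , <q , uq≤ = ⊥-elim (<-irrefl refl (<-≤-trans (pred< 0<ui) (subst (λ t → val u t ≤ ℕ.pred (val u i)) q≡i uq≤)))
  where
  ui<q : val u i < toℕ q
  ui<q = ≤∧≢⇒< (pred<⇒≤ 0<ui <q)
                (λ e → <-asym (≤-<-trans uq≤ (pred< 0<ui)) (subst (λ t → val u i < val u t) (toℕ-injective e) ui<uui))
  q≡i = boolean⇒crossesDown-unique u bu (ui<q , ≤-trans uq≤ (<⇒≤ (pred< 0<ui))) (ui<i , ≤-refl)

-- The inverse of the paper's boolean part: u is a boolean right factor of x (= w⁻¹) with the same support.
record BooleanCore {n} (x u : Perm n) : Set where
  field
    boolean : Boolean u
    ≤ᴸx     : u ≤ᴸ x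
    cuts⊆   : Crossed u ⊆ Crossed x
    cuts⊇   : Crossed x ⊆ Crossed u

module _ {n} {x v₁ v₂ : Perm n} (fc : FullyCommutative x) (core₁ : BooleanCore x v₁) (core₂ : BooleanCore x v₂) where
  open BooleanCore core₁ renaming (boolean to b₁; ≤ᴸx to v₁≤x; cuts⊆ to cuts₁⊆; cuts⊇ to cuts₁⊇)
  open BooleanCore core₂ renaming (boolean to b₂; ≤ᴸx to v₂≤x; cuts⊆ to cuts₂⊆; cuts⊇ to cuts₂⊇)

  -- m crosses upwards the cut at m in v₁, and downwards the cut at v₂ m in v₂; both give an inversion of x.
  ¬excedance-deficiency : ∀ m → toℕ m < val v₁ m → val v₂ m < toℕ m → ⊥
  ¬excedance-deficiency m m<v₁m v₂m<m
    with Crossed⇒crossesDown v₁ (m , ≤-refl , m<v₁m) | crossesDown⇒Crossed v₂ m (v₂m<m , ≤-refl)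
  ... | q , m<q , v₁q≤m | p , p≤v₂m , v₂m<v₂p =
    fc (p , m , q , p<m , m<q , proj₂ (v₁≤x (m<q , ≤-<-trans v₁q≤m m<v₁m)) , proj₂ (v₂≤x (p<m , v₂m<v₂p)))
    where p<m = ≤-<-trans p≤v₂m v₂m<m

  ¬excedances-< : ∀ i → toℕ i < val v₁ i → ¬ (val v₁ i < val v₂ i)
  ¬excedances-< i i<v₁i v₁i<v₂i = ¬excedance-deficiency t t<v₁t v₂t<t
    where
    t = v₁ ⟨$⟩ʳ i
    v₂t<t : val v₂ t < toℕ t
    v₂t<t = excedance-covers-deficiencies v₂ b₂ i<v₁i v₁i<v₂i
    t<v₁t : toℕ t < val v₁ t
    t<v₁t = excedance-value-excedance v₁ b₁ i<v₁i (cuts₁⊇ (cuts₂⊆ (i , <⇒≤ i<v₁i , v₁i<v₂i)))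

  ¬deficiencies-< : ∀ i → val v₂ i < toℕ i → ¬ (val v₁ i < val v₂ i)
  ¬deficiencies-< i v₂i<i v₁i<v₂i = ¬excedance-deficiency t t<v₁t v₂t<t
    where
    t = v₂ ⟨$⟩ʳ i
    0<v₂i = ≤-<-trans z≤n v₁i<v₂i
    t<v₁t : toℕ t < val v₁ t
    t<v₁t = deficiency-covers-excedances v₁ b₁ v₁i<v₂i v₂i<i
    v₂t<t : val v₂ t < toℕ t
    v₂t<t = deficiency-value-deficiency v₂ b₂ v₂i<i 0<v₂i
              (cuts₂⊇ (cuts₁⊆ (crossesDown⇒Crossed v₁ i (<-trans (pred< 0<v₂i) v₂i<i , <⇒≤pred v₁i<v₂i))))

  excedance⇒¬fixed : ∀ i → toℕ i < val v₁ i → val v₂ i ≢ toℕ i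
  excedance⇒¬fixed i i<v₁i fix = fixedPoint⇒¬Crossed v₂ (proj₁ b₂) i fix (cuts₂⊇ (cuts₁⊆ (i , ≤-refl , i<v₁i)))

  deficiency⇒¬fixed : ∀ i → val v₁ i < toℕ i → val v₂ i ≢ toℕ i
  deficiency⇒¬fixed i v₁i<i fix = fixedPoint⇒¬Crossed v₂ (proj₁ b₂) i fix (fixedPoint-Crossed-pred v₂ i fix 0<i
                                    (cuts₂⊇ (cuts₁⊆ (crossesDown⇒Crossed v₁ i (pred< v₁i<i , <⇒≤pred v₁i<i)))))
    where 0<i = ≤-<-trans z≤n v₁i<i

booleanCore-unique : ∀ {n} {x u₁ u₂ : Perm n} → FullyCommutative x → BooleanCore x u₁ → BooleanCore x u₂ → u₁ ≈ u₂
booleanCore-unique {x = x} {u₁} {u₂} fc core₁ core₂ i =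
  toℕ-injective (compare (<-cmp (val u₁ i) (toℕ i)) (<-cmp (val u₂ i) (toℕ i)))
  where
  compare : Tri (val u₁ i < toℕ i) (val u₁ i ≡ toℕ i) (toℕ i < val u₁ i) →
            Tri (val u₂ i < toℕ i) (val u₂ i ≡ toℕ i) (toℕ i < val u₂ i) → val u₁ i ≡ val u₂ i
  compare (tri≈ _ fix₁ _) (tri≈ _ fix₂ _) = trans fix₁ (sym fix₂)
  compare (tri> _ _ exc₁) (tri> _ _ exc₂) = ≤-antisym (≮⇒≥ (¬excedances-< fc core₂ core₁ i exc₂))
                                                      (≮⇒≥ (¬excedances-< fc core₁ core₂ i exc₁))
  compare (tri< def₁ _ _) (tri< def₂ _ _) = ≤-antisym (≮⇒≥ (¬deficiencies-< fc core₂ core₁ i def₁))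
                                                      (≮⇒≥ (¬deficiencies-< fc core₁ core₂ i def₂))
  compare (tri> _ _ exc₁) (tri< def₂ _ _) = ⊥-elim (¬excedance-deficiency fc core₁ core₂ i exc₁ def₂)
  compare (tri< def₁ _ _) (tri> _ _ exc₂) = ⊥-elim (¬excedance-deficiency fc core₂ core₁ i exc₂ def₁)
  compare (tri> _ _ exc₁) (tri≈ _ fix₂ _) = ⊥-elim (excedance⇒¬fixed fc core₁ core₂ i exc₁ fix₂)
  compare (tri≈ _ fix₁ _) (tri> _ _ exc₂) = ⊥-elim (excedance⇒¬fixed fc core₂ core₁ i exc₂ fix₁)
  compare (tri< def₁ _ _) (tri≈ _ fix₂ _) = ⊥-elim (deficiency⇒¬fixed fc core₁ core₂ i def₁ fix₂)
  compare (tri≈ _ fix₁ _) (tri< def₂ _ _) = ⊥-elim (deficiency⇒¬fixed fc core₂ core₁ i def₂ fix₁)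

Crossed? : ∀ {n} (v : Perm n) k → Dec (Crossed v k)
Crossed? v k = FP.any? (crossesUp? v k)

module _ {n} (u : Perm n) {k} (k∉ : ¬ Crossed u k) where

  ¬Crossed⇒val≤ : ∀ {p} → toℕ p ≤ k → val u p ≤ k
  ¬Crossed⇒val≤ {p} p≤k = ≮⇒≥ (λ k<up → k∉ (p , p≤k , k<up))

  ¬Crossed⇒<val : ∀ {q} → k < toℕ q → k < val u q
  ¬Crossed⇒<val {q} k<q = ≰⇒> (λ uq≤k → k∉ (crossesDown⇒Crossed u q (k<q , uq≤k)))

module _ {n} (u : Perm n) (l : Letter n) (k∉ : ¬ Crossed u (proj₁ l)) where

  ¬Crossed⇒⟨$⟩ˡ-lo≤ : toℕ (u ⟨$⟩ˡ lo l) ≤ proj₁ l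
  ¬Crossed⇒⟨$⟩ˡ-lo≤ = ≮⇒≥ (λ k<a → <-irrefl (sym (val-⟨$⟩ˡ-lo u l)) (¬Crossed⇒<val u k∉ k<a))

  ¬Crossed⇒<⟨$⟩ˡ-hi : proj₁ l < toℕ (u ⟨$⟩ˡ hi l)
  ¬Crossed⇒<⟨$⟩ˡ-hi =
    ≰⇒> (λ b≤k → k∉ (u ⟨$⟩ˡ hi l , b≤k , subst (proj₁ l <_) (sym (val-⟨$⟩ˡ-hi u l)) (n<1+n _)))

  ¬Crossed⇒ascent : Ascent u l
  ¬Crossed⇒ascent = ≤-<-trans ¬Crossed⇒⟨$⟩ˡ-lo≤ ¬Crossed⇒<⟨$⟩ˡ-hi

module _ {n} (u : Perm n) (l : Letter n) (k∉ : ¬ Crossed u (proj₁ l)) where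
  private
    k = proj₁ l
    a = u ⟨$⟩ˡ lo l
    b = u ⟨$⟩ˡ hi l
    v = s l · u
    a≤k = ¬Crossed⇒⟨$⟩ˡ-lo≤ u l k∉
    k<b = ¬Crossed⇒<⟨$⟩ˡ-hi u l k∉
    a<b = ¬Crossed⇒ascent u l k∉

    ¬b-before-a : ∀ {c d} → toℕ c < toℕ d → ¬ (c ≡ b × d ≡ a)
    ¬b-before-a c<d (refl , refl) = <-asym c<d a<b

    val-left : ∀ {c} → toℕ c ≤ k → c ≢ a → val v c < k
    val-left {c} c≤k c≢a = subst (_< k) (sym (trans (val-s· l u c) (swapℕ-other uc≢k uc≢1+k))) uc<k
      where
      uc≢k : val u c ≢ k
      uc≢k = c≢a ∘ val≡k⇒⟨$⟩ˡ-lo u l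
      uc<k = ≤∧≢⇒< (¬Crossed⇒val≤ u k∉ c≤k) uc≢k
      uc≢1+k : val u c ≢ suc k
      uc≢1+k e = <-asym uc<k (subst (k <_) (sym e) (n<1+n k))

    val-right : ∀ {c} → k < toℕ c → c ≢ b → suc k < val v c
    val-right {c} k<c c≢b = subst (suc k <_) (sym (trans (val-s· l u c) (swapℕ-other uc≢k uc≢1+k))) 1+k<uc
      where
      uc≢1+k : val u c ≢ suc k
      uc≢1+k = c≢b ∘ val≡1+k⇒⟨$⟩ˡ-hi u l
      1+k<uc = ≤∧≢⇒< (¬Crossed⇒<val u k∉ k<c) (uc≢1+k ∘ sym)
      uc≢k : val u c ≢ k
      uc≢k e = <-irrefl (sym e) (<-trans (n<1+n k) 1+k<uc)

    reflects : ∀ {c d} → ¬ (c ≡ b × d ≡ a) → val v c < val v d → val u c < val u d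
    reflects {c} {d} ¬ba h = swapℕ-reflects-< k (subst₂ _<_ (val-s· l u c) (val-s· l u d) h)
                               (λ (e₁ , e₂) → ¬ba (val≡1+k⇒⟨$⟩ˡ-hi u l e₁ , val≡k⇒⟨$⟩ˡ-lo u l e₂))

    ab? : ∀ c d → Dec (c ≡ a × d ≡ b)
    ab? c d = (c FP.≟ a) ×-dec (d FP.≟ b)

  FullyCommutative-s· : FullyCommutative u → FullyCommutative v
  FullyCommutative-s· fc (i , j , m , i<j , j<m , vm<vj , vj<vi) with ab? i j | ab? j m
  ... | yes (refl , refl) | _ = <-asym (val-right (<-trans k<b j<m) (λ m≡b → <-irrefl (cong toℕ (sym m≡b)) j<m))
                                       (<-trans (subst (val v m <_) (val-s·-⟨$⟩ˡ-hi l u) vm<vj) (n<1+n k))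
  ... | no _ | yes (refl , refl) =
    <-asym (<-trans (val-left (<⇒≤ (<-≤-trans i<j a≤k)) (λ i≡a → <-irrefl (cong toℕ i≡a) i<j)) (n<1+n k))
           (subst (_< val v i) (val-s·-⟨$⟩ˡ-lo l u) vj<vi)
  ... | no ¬ij | no ¬jm = fc (i , j , m , i<j , j<m , reflects (λ (e₁ , e₂) → ¬jm (e₂ , e₁)) vm<vj
                                                    , reflects (λ (e₁ , e₂) → ¬ij (e₂ , e₁)) vj<vi)

  ¬Contains3412-s· : ¬ Contains3412 u → ¬ Contains3412 v
  ¬Contains3412-s· ¬3412 (i , j , m , o , i<j , j<m , m<o , vm<vo , vo<vi , vi<vj) with ab? i o
  ... | yes (refl , refl) = [ (λ j≤k → <-asym (val-left j≤k (λ j≡a → <-irrefl (cong toℕ (sym j≡a)) i<j))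
                                              (<-trans (subst (k <_) (sym (val-s·-⟨$⟩ˡ-lo l u)) (n<1+n k)) vi<vj))
                            , (λ k<j → <-asym (val-right (<-trans k<j j<m) (λ m≡b → <-irrefl (cong toℕ m≡b) m<o))
                                              (<-trans (subst (val v m <_) (val-s·-⟨$⟩ˡ-hi l u) vm<vo) (n<1+n k))) ]′
                            (≤-<-connex (toℕ j) k)
  ... | no ¬io = ¬3412 (i , j , m , o , i<j , j<m , m<o , reflects (¬b-before-a m<o) vm<vo
                                                     , reflects (λ (e₁ , e₂) → ¬io (e₂ , e₁)) vo<vi
                                                     , reflects (¬b-before-a i<j) vi<vj)

  Boolean-s· : Boolean u → Boolean v
  Boolean-s· (¬321 , ¬3412) = FullyCommutative-s· ¬321 , ¬Contains3412-s· ¬3412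

  ≤ᴸ-s· : ∀ {x} → u ≤ᴸ x → x ⟨$⟩ˡ lo l ≡ a → x ⟨$⟩ˡ hi l ≡ b → v ≤ᴸ s l · x
  ≤ᴸ-s· {x} u≤x xa≡a xb≡b {i} {j} (i<j , vj<vi) with ab? i j
  ... | yes (refl , refl) = i<j , subst₂ _<_ (sym (trans (cong (val (s l · x)) (sym xb≡b)) (val-s·-⟨$⟩ˡ-hi l x)))
                                             (sym (trans (cong (val (s l · x)) (sym xa≡a)) (val-s·-⟨$⟩ˡ-lo l x))) (n<1+n k)
  ... | no ¬ij = s·-inversion⁺ l x (subst₂ (λ c d → toℕ c < toℕ d) (sym xa≡a) (sym xb≡b) a<b)
                   (u≤x (i<j , reflects (λ (e₁ , e₂) → ¬ij (e₂ , e₁)) vj<vi))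

-- Here 321-avoidance of x forces x and u to put the values k and k+1 at the same positions.
module _ {n} {x u : Perm n} (fc : FullyCommutative x) (u≤x : u ≤ᴸ x) (cuts⊆ : Crossed u ⊆ Crossed x)
         (cuts⊇ : Crossed x ⊆ Crossed u) (l : Letter n) (k∉x : ¬ Crossed x (proj₁ l)) where
  private
    k = proj₁ l
    k∉u : ¬ Crossed u k
    k∉u = k∉x ∘ cuts⊆
    c = x ⟨$⟩ˡ lo l
    a = u ⟨$⟩ˡ lo l
    d = x ⟨$⟩ˡ hi l
    b = u ⟨$⟩ˡ hi l

    ¬a<c : toℕ a < toℕ c → ⊥
    ¬a<c a<c = <-irrefl refl (<-≤-trans (subst (_< val x a) (val-⟨$⟩ˡ-lo x l) (proj₂ (u≤x (a<c , uc<ua))))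
                                        (¬Crossed⇒val≤ x k∉x (¬Crossed⇒⟨$⟩ˡ-lo≤ u l k∉u)))
      where
      uc<ua : val u c < val u a
      uc<ua = subst (val u c <_) (sym (val-⟨$⟩ˡ-lo u l))
                (≤∧≢⇒< (¬Crossed⇒val≤ u k∉u (¬Crossed⇒⟨$⟩ˡ-lo≤ x l k∉x))
                       (λ e → <-irrefl (cong toℕ (sym (val≡k⇒⟨$⟩ˡ-lo u l e))) a<c))

    ¬c<a<k : toℕ c < toℕ a → toℕ a < k → ⊥
    ¬c<a<k c<a a<k = fc (c , a , lo l , c<a , a<K , proj₂ (u≤x (a<K , uK<ua)) , xa<xc)
      where
      a<K : toℕ a < toℕ (lo l)
      a<K = subst (toℕ a <_) (sym (toℕ-lo l)) a<k
      uK<ua : val u (lo l) < val u a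
      uK<ua = subst (val u (lo l) <_) (sym (val-⟨$⟩ˡ-lo u l))
                (≤∧≢⇒< (¬Crossed⇒val≤ u k∉u (≤-reflexive (toℕ-lo l)))
                       (λ e → <-irrefl (cong toℕ (sym (val≡k⇒⟨$⟩ˡ-lo u l e))) a<K))
      xa<xc : val x a < val x c
      xa<xc = subst (val x a <_) (sym (val-⟨$⟩ˡ-lo x l))
                (≤∧≢⇒< (¬Crossed⇒val≤ x k∉x (<⇒≤ a<k))
                       (λ e → <-irrefl (cong toℕ (sym (val≡k⇒⟨$⟩ˡ-lo x l e))) c<a))

    -- x moves c across the cut below k, hence so does u; as u puts k at position k, this crossing goes beyond k.
    ¬c<a≡k : toℕ c < toℕ a → toℕ a ≡ k → ⊥
    ¬c<a≡k c<a a≡k = k∉u (p , <⇒≤ (≤-<-trans p≤ (pred< 0<k)) , ≤∧≢⇒< (pred<⇒≤ 0<k <up) k≢up)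
      where
      c<k = subst (toℕ c <_) a≡k c<a
      0<k = ≤-<-trans z≤n c<k
      crossing = cuts⊇ (c , <⇒≤pred c<k , subst (ℕ.pred k <_) (sym (val-⟨$⟩ˡ-lo x l)) (pred< 0<k))
      p = proj₁ crossing
      p≤ = proj₁ (proj₂ crossing)
      <up = proj₂ (proj₂ crossing)
      k≢up : k ≢ val u p
      k≢up e = <-irrefl (trans (cong toℕ (val≡k⇒⟨$⟩ˡ-lo u l (sym e))) a≡k) (≤-<-trans p≤ (pred< 0<k))

    ¬d<b : toℕ d < toℕ b → ⊥
    ¬d<b d<b = <-irrefl refl (<-≤-trans (¬Crossed⇒<val x k∉x (¬Crossed⇒<⟨$⟩ˡ-hi u l k∉u))
                                        (≤-pred (subst (val x b <_) (val-⟨$⟩ˡ-hi x l) (proj₂ (u≤x (d<b , ub<ud))))))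
      where
      ub<ud : val u b < val u d
      ub<ud = subst (_< val u d) (sym (val-⟨$⟩ˡ-hi u l))
                (≤∧≢⇒< (¬Crossed⇒<val u k∉u (¬Crossed⇒<⟨$⟩ˡ-hi x l k∉x))
                       (λ e → <-irrefl (cong toℕ (val≡1+k⇒⟨$⟩ˡ-hi u l (sym e))) d<b))

    ¬1+k<b<d : suc k < toℕ b → toℕ b < toℕ d → ⊥
    ¬1+k<b<d K<b b<d = fc (hi l , b , d , K<b′ , b<d , xd<xb , proj₂ (u≤x (K<b′ , ub<uK)))
      where
      K<b′ : toℕ (hi l) < toℕ b
      K<b′ = subst (_< toℕ b) (sym (toℕ-hi l)) K<b
      ub<uK : val u b < val u (hi l)
      ub<uK = subst (_< val u (hi l)) (sym (val-⟨$⟩ˡ-hi u l))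
                (≤∧≢⇒< (¬Crossed⇒<val u k∉u (subst (k <_) (sym (toℕ-hi l)) (n<1+n k)))
                       (λ e → <-irrefl (cong toℕ (val≡1+k⇒⟨$⟩ˡ-hi u l (sym e))) K<b′))
      xd<xb : val x d < val x b
      xd<xb = subst (_< val x b) (sym (val-⟨$⟩ˡ-hi x l))
                (≤∧≢⇒< (¬Crossed⇒<val x k∉x (<-trans (n<1+n k) K<b))
                       (λ e → <-irrefl (cong toℕ (val≡1+k⇒⟨$⟩ˡ-hi x l (sym e))) b<d))

    -- x moves d across the cut above k+1, hence so does u; as u puts k+1 at position k+1, this crossing goes below k+1.
    ¬b≡1+k<d : toℕ b ≡ suc k → toℕ b < toℕ d → ⊥
    ¬b≡1+k<d b≡1+k b<d = k∉u (crossesDown⇒Crossed u q (<-trans (n<1+n k) 1+k<q , ≤-pred (≤∧≢⇒< uq≤1+k uq≢1+k)))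
      where
      crossing = Crossed⇒crossesDown u
                   (cuts⊇ (crossesDown⇒Crossed x d (subst (_< toℕ d) b≡1+k b<d , ≤-reflexive (val-⟨$⟩ˡ-hi x l))))
      q = proj₁ crossing
      1+k<q = proj₁ (proj₂ crossing)
      uq≤1+k = proj₂ (proj₂ crossing)
      uq≢1+k : val u q ≢ suc k
      uq≢1+k e = <-irrefl (sym (trans (cong toℕ (val≡1+k⇒⟨$⟩ˡ-hi u l e)) b≡1+k)) 1+k<q

  ⟨$⟩ˡ-lo-agree : x ⟨$⟩ˡ lo l ≡ u ⟨$⟩ˡ lo l
  ⟨$⟩ˡ-lo-agree with <-cmp (toℕ c) (toℕ a)
  ... | tri≈ _ e _   = toℕ-injective e
  ... | tri> _ _ a<c = ⊥-elim (¬a<c a<c)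
  ... | tri< c<a _ _ = ⊥-elim ([ ¬c<a<k c<a , ¬c<a≡k c<a ]′ (m≤n⇒m<n∨m≡n (¬Crossed⇒⟨$⟩ˡ-lo≤ u l k∉u)))

  ⟨$⟩ˡ-hi-agree : x ⟨$⟩ˡ hi l ≡ u ⟨$⟩ˡ hi l
  ⟨$⟩ˡ-hi-agree with <-cmp (toℕ d) (toℕ b)
  ... | tri≈ _ e _   = toℕ-injective e
  ... | tri< d<b _ _ = ⊥-elim (¬d<b d<b)
  ... | tri> _ _ b<d = ⊥-elim ([ (λ 1+k<b → ¬1+k<b<d 1+k<b b<d) , (λ b≡1+k → ¬b≡1+k<d (sym b≡1+k) b<d) ]′
                                 (m≤n⇒m<n∨m≡n (¬Crossed⇒<⟨$⟩ˡ-hi u l k∉u)))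

⊆-except : ∀ {p q} {P : ℕ → Set p} {Q : ℕ → Set q} k → P k → (∀ {j} → j ≢ k → Q j → P j) → Q ⊆ P
⊆-except k Pk others {j} Qj with j ℕ.≟ k
... | yes refl = Pk
... | no j≢k   = others j≢k Qj

booleanCore-exists : ∀ {n} (x : Perm n) → FullyCommutative x → Σ (Perm n) (BooleanCore x)
booleanCore-exists {n} = descent-induction (λ x → FullyCommutative x → Σ (Perm n) (BooleanCore x)) base step
  where
  base : ∀ x → x ≈ P.id → FullyCommutative x → Σ (Perm n) (BooleanCore x)
  base x x≈id _ = P.id , record
    { boolean = boolean-id
    ; ≤ᴸx     = λ (i<j , j<i) → ⊥-elim (<-asym i<j j<i)
    ; cuts⊆   = λ c → ⊥-elim (¬Crossed-id _ c)
    ; cuts⊇   = Crossed-cong {u = x} {P.id} x≈id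
    }
  step : ∀ x l → Descent x l → (FullyCommutative (s l · x) → Σ (Perm n) (BooleanCore (s l · x))) →
         FullyCommutative x → Σ (Perm n) (BooleanCore x)
  step x l dsc ih fc = extend (ih fc₁) (Crossed? x₁ k)
    where
    k = proj₁ l
    x₁ = s l · x
    x₁≤x = descent⇒s·≤ᴸ x l dsc
    fc₁ = ≤ᴸ-FullyCommutative {u = x₁} {x} x₁≤x fc
    k∈x : Crossed x k
    k∈x = Crossed-cong {u = s l · x₁} {x} (s·s· l x) (ascent⇒Crossed-s· l x₁ (descent⇒ascent-s· x l dsc))
    extend : Σ (Perm n) (BooleanCore x₁) → Dec (Crossed x₁ k) → Σ (Perm n) (BooleanCore x)
    extend (u₁ , core₁) (yes k∈x₁) = u₁ , record
      { boolean = boolean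
      ; ≤ᴸx     = ≤ᴸ-trans {u = u₁} {x₁} {x} ≤ᴸx x₁≤x
      ; cuts⊆   = ⊆-except k k∈x (λ j≢k → Crossed-s·⇒ l x j≢k ∘ cuts⊆)
      ; cuts⊇   = ⊆-except k (cuts⊇ k∈x₁) (λ j≢k → cuts⊇ ∘ Crossed-s·⇐ l x j≢k)
      }
      where open BooleanCore core₁
    extend (u₁ , core₁) (no k∉x₁) = s l · u₁ , record
      { boolean = Boolean-s· u₁ l k∉u₁ boolean
      ; ≤ᴸx     = ≤ᴸ-respʳ-≈ {u = s l · u₁} {s l · x₁} {x} (s·s· l x)
                    (≤ᴸ-s· u₁ l k∉u₁ {x₁} ≤ᴸx (⟨$⟩ˡ-lo-agree {x = x₁} {u₁} fc₁ ≤ᴸx cuts⊆ cuts⊇ l k∉x₁)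
                                              (⟨$⟩ˡ-hi-agree {x = x₁} {u₁} fc₁ ≤ᴸx cuts⊆ cuts⊇ l k∉x₁))
      ; cuts⊆   = ⊆-except k k∈x (λ j≢k → Crossed-s·⇒ l x j≢k ∘ cuts⊆ ∘ Crossed-s·⇒ l u₁ j≢k)
      ; cuts⊇   = ⊆-except k (ascent⇒Crossed-s· l u₁ (¬Crossed⇒ascent u₁ l k∉u₁))
                    (λ j≢k → Crossed-s·⇐ l u₁ j≢k ∘ cuts⊇ ∘ Crossed-s·⇐ l x j≢k)
      }
      where
      open BooleanCore core₁
      k∉u₁ = k∉x₁ ∘ cuts⊆

ℓ-additive⇒≤ᴸ : ∀ {n} {x : Perm n} y u → x ≈ y · u → ℓ x ≡ ℓ y + ℓ u → u ≤ᴸ x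
ℓ-additive⇒≤ᴸ {x = x} y u x≈yu ℓ≡ with reducedWord y | reducedWord u
... | vs , prod-vs≈y , len-vs | us , prod-us≈u , len-us =
  ≤ᴸ-respʳ-≈ {u = u} {prod (vs ++ us)} {x} prod≈x
    (≤ᴸ-respˡ-≈ {u = prod us} {u} {prod (vs ++ us)} prod-us≈u (reduced-suffix-≤ᴸ vs us reduced))
  where
  prod≈x : prod (vs ++ us) ≈ x
  prod≈x i = begin
    prod (vs ++ us) ⟨$⟩ʳ i            ≡⟨ prod-++ vs us i ⟩
    prod vs ⟨$⟩ʳ (prod us ⟨$⟩ʳ i)     ≡⟨ cong (prod vs ⟨$⟩ʳ_) (prod-us≈u i) ⟩
    prod vs ⟨$⟩ʳ (u ⟨$⟩ʳ i)           ≡⟨ prod-vs≈y (u ⟨$⟩ʳ i) ⟩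
    y ⟨$⟩ʳ (u ⟨$⟩ʳ i)                 ≡⟨ x≈yu i ⟨
    x ⟨$⟩ʳ i                          ∎
    where open ≡-Reasoning
  reduced : Reduced (vs ++ us)
  reduced = begin
    ℓ (prod (vs ++ us))       ≡⟨ ℓ-cong {u = prod (vs ++ us)} {x} prod≈x ⟩
    ℓ x                       ≡⟨ ℓ≡ ⟩
    ℓ y + ℓ u                 ≡⟨ cong₂ _+_ len-vs len-us ⟨
    length vs + length us     ≡⟨ length-++ vs ⟨
    length (vs ++ us)         ∎
    where open ≡-Reasoning

InSupp⇒Crossed-flip : ∀ {n} (v : Perm n) {k} → InSupp v k → Crossed (flip v) k
InSupp⇒Crossed-flip v = Crossed-flip v ∘ InSupp⇒Crossed v

Crossed-flip⇒InSupp : ∀ {n} (v : Perm n) {k} → Crossed (flip v) k → InSupp v k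
Crossed-flip⇒InSupp v = Crossed⇒InSupp v ∘ Crossed-flip (flip v)

booleanCore⇒BoolFactor : ∀ {n} (w u : Perm n) → BooleanCore (flip w) u → BoolFactor w (flip u)
booleanCore⇒BoolFactor w u core = u · w , (λ i → sym (inverseˡ u)) , ℓ-split , Boolean-flip u boolean ,
  λ k → Crossed-flip⇒InSupp w ∘ cuts⊆ ∘ InSupp⇒Crossed-flip (flip u)
      , Crossed-flip⇒InSupp (flip u) ∘ cuts⊇ ∘ InSupp⇒Crossed-flip w
  where
  open BooleanCore core
  open ≡-Reasoning
  ℓ-split : ℓ w ≡ ℓ (flip u) + ℓ (u · w)
  ℓ-split = begin
    ℓ w                                ≡⟨ ℓ-flip w ⟨
    ℓ (flip w)                         ≡⟨ ≤ᴸ⇒ℓ-additive u (flip w) ≤ᴸx ⟩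
    ℓ u + ℓ (flip (u · w))             ≡⟨ cong₂ _+_ (sym (ℓ-flip u)) (ℓ-flip (u · w)) ⟩
    ℓ (flip u) + ℓ (u · w)             ∎

BoolFactor⇒booleanCore : ∀ {n} (w ŵ : Perm n) → BoolFactor w ŵ → BooleanCore (flip w) (flip ŵ)
BoolFactor⇒booleanCore w ŵ (w′ , w≈ŵw′ , ℓ≡ , b , supp) = record
  { boolean = Boolean-flip ŵ b
  ; ≤ᴸx     = ℓ-additive⇒≤ᴸ {x = flip w} (flip w′) (flip ŵ) (flip-cong {u = w} {ŵ · w′} w≈ŵw′) (begin
      ℓ (flip w)                 ≡⟨ ℓ-flip w ⟩
      ℓ w                        ≡⟨ ℓ≡ ⟩
      ℓ ŵ + ℓ w′                 ≡⟨ +-comm (ℓ ŵ) (ℓ w′) ⟩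
      ℓ w′ + ℓ ŵ                 ≡⟨ cong₂ _+_ (ℓ-flip w′) (ℓ-flip ŵ) ⟨
      ℓ (flip w′) + ℓ (flip ŵ)   ∎)
  ; cuts⊆   = λ {k} → InSupp⇒Crossed-flip w ∘ proj₁ (supp k) ∘ Crossed-flip⇒InSupp ŵ
  ; cuts⊇   = λ {k} → InSupp⇒Crossed-flip ŵ ∘ proj₂ (supp k) ∘ Crossed-flip⇒InSupp w
  }
  where open ≡-Reasoning

theorem3p2 : (n : ℕ) (w : Perm n) → FullyCommutative w →
    Σ (Perm n) (λ ŵ → BoolFactor w ŵ) ×
    (∀ ŵ₁ ŵ₂ → BoolFactor w ŵ₁ → BoolFactor w ŵ₂ → ŵ₁ ≈ ŵ₂)
theorem3p2 n w fc = (flip u , booleanCore⇒BoolFactor w u core) , unique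
  where
  fc⁻¹ : FullyCommutative (flip w)
  fc⁻¹ = fc ∘ Contains321-flip w
  u = proj₁ (booleanCore-exists (flip w) fc⁻¹)
  core = proj₂ (booleanCore-exists (flip w) fc⁻¹)
  unique : ∀ ŵ₁ ŵ₂ → BoolFactor w ŵ₁ → BoolFactor w ŵ₂ → ŵ₁ ≈ ŵ₂
  unique ŵ₁ ŵ₂ f₁ f₂ = flip-cong {u = flip ŵ₁} {flip ŵ₂}
    (booleanCore-unique fc⁻¹ (BoolFactor⇒booleanCore w ŵ₁ f₁) (BoolFactor⇒booleanCore w ŵ₂ f₂))
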